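{- Let $\mathcal{M}^{\le\ge}$ be the set of Dyck paths whose sequence of peak heights (read left to right) is weakly unimodal. For a Dyck path $D$ let $|D|$ be its semilength and $\mathrm{sval}(D)$ the number of pairs of consecutive peaks of $D$ at the same height. Writing $[i]_z=1+z+\dots+z^{i-1}$, $$\sum_{D\in\mathcal{M}^{\le\ge}}s^{\mathrm{sval}(D)}z^{|D|}=1+\sum_{a\ge1}\frac{z^a}{1-sz[a]_z}\left(\prod_{i=1}^{a-1}\frac{1+(1-s)z[i]_z}{1-sz[i]_z}\right)^2.$$
   Context: A Dyck path of semilength $n$ is a lattice path with steps $\mathbf{u}=(1,1)$ and $\mathbf{d}=(1,-1)$ from $(0,0)$ to $(2n,0)$ never going below the $x$-axis. A peak is an occurrence of consecutive steps $\mathbf{ud}$; its height is the $y$-coordinate of its highest vertex. Two peaks are consecutive if no other peak lies between them. A sequence $a_1,\dots,a_k$ is weakly unimodal if there is $j$ with $a_1\le\dots\le a_j\ge a_{j+1}\ge\dots\ge a_k$; the empty path is included. -}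

module Defs where

open import Data.Bool using (Bool; true; false; _∧_; _∨_; if_then_else_)
open import Data.Nat as ℕ using (ℕ; zero; suc; _∸_; pred)
open import Data.Nat using (_≡ᵇ_; _≤ᵇ_; _<ᵇ_)
open import Data.Integer as ℤ using (ℤ; +_)
open import Data.List using (List; []; _∷_; length; filterᵇ; map; concatMap; take; drop; upTo; foldr)

data Step : Set where
  u d : Step

words : ℕ → List (List Step)
words zero    = [] ∷ []
words (suc m) = concatMap (λ w → (u ∷ w) ∷ (d ∷ w) ∷ []) (words m)

validAt : ℕ → List Step → Bool
validAt h       []       = h ≡ᵇ 0
validAt h       (u ∷ w)  = validAt (suc h) w
validAt zero    (d ∷ w)  = false
validAt (suc h) (d ∷ w)  = validAt h w

isDyck : List Step → Bool
isDyck = validAt 0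

-- heights of the peaks (occurrences of u d), read left to right,
-- for a path starting at height h; the height of a peak is the
-- y-coordinate of its top vertex.
peaksAt : ℕ → List Step → List ℕ
peaksAt h []            = []
peaksAt h (u ∷ d ∷ w)   = suc h ∷ peaksAt h w
peaksAt h (u ∷ w)       = peaksAt (suc h) w
peaksAt h (d ∷ w)       = peaksAt (pred h) w

peaks : List Step → List ℕ
peaks = peaksAt 0

nondecr : List ℕ → Bool
nondecr []            = true
nondecr (x ∷ [])      = true
nondecr (x ∷ y ∷ xs)  = (x ≤ᵇ y) ∧ nondecr (y ∷ xs)

nonincr : List ℕ → Bool
nonincr []            = true
nonincr (x ∷ [])      = true
nonincr (x ∷ y ∷ xs)  = (y ≤ᵇ x) ∧ nonincr (y ∷ xs)

anyᵇ : List Bool → Bool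
anyᵇ = foldr _∨_ false

-- j ranges over 0..k (j = 0 only matters for the empty sequence);
-- condition: a_1..a_j nondecreasing and a_j, a_{j+1}, …, a_k nonincreasing
weaklyUnimodal : List ℕ → Bool
weaklyUnimodal xs =
  anyᵇ (map (λ j → nondecr (take j xs) ∧ nonincr (drop (j ∸ 1) xs))
            (upTo (suc (length xs))))

eqPairs : List ℕ → ℕ
eqPairs []           = 0
eqPairs (x ∷ [])     = 0
eqPairs (x ∷ y ∷ xs) = (if x ≡ᵇ y then 1 else 0) ℕ.+ eqPairs (y ∷ xs)

sval : List Step → ℕ
sval w = eqPairs (peaks w)

lhsCoeff : ℕ → ℕ → ℕ
lhsCoeff n k = length (filterᵇ (λ w → isDyck w ∧ weaklyUnimodal (peaks w) ∧ (sval w ≡ᵇ k))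
                               (words (n ℕ.+ n)))

-- Formal power series in z with coefficients in ℤ[s]:
-- F n k = coefficient of z^n s^k.

Ser : Set
Ser = ℕ → ℕ → ℤ

sumTo : ℕ → (ℕ → ℤ) → ℤ
sumTo zero    f = f 0
sumTo (suc n) f = sumTo n f ℤ.+ f (suc n)

_⊕_ : Ser → Ser → Ser
(F ⊕ G) n k = F n k ℤ.+ G n k

_⊖_ : Ser → Ser → Ser
(F ⊖ G) n k = F n k ℤ.- G n k

_⊗_ : Ser → Ser → Ser
(F ⊗ G) n k = sumTo n (λ i → sumTo k (λ j → F i j ℤ.* G (n ∸ i) (k ∸ j)))

infixl 6 _⊕_ _⊖_
infixl 7 _⊗_

mono : ℕ → ℕ → Ser
mono a b n k = if (n ≡ᵇ a) ∧ (k ≡ᵇ b) then + 1 else + 0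

𝟙 zS sS : Ser
𝟙  = mono 0 0
zS = mono 1 0
sS = mono 0 1

_^ˢ_ : Ser → ℕ → Ser
F ^ˢ zero  = 𝟙
F ^ˢ suc m = F ⊗ (F ^ˢ m)

bracket : ℕ → Ser
bracket zero    = λ _ _ → + 0
bracket (suc i) = bracket i ⊕ mono i 0

-- 1/(1 - X) for a series X with no z^0 term: Σ_{m≥0} X^m.
-- (The coefficient of z^n only receives contributions from m ≤ n.)
geom : Ser → Ser
geom X n k = sumTo n (λ m → (X ^ˢ m) n k)

prodFrom1 : ℕ → (ℕ → Ser) → Ser
prodFrom1 zero          f = 𝟙
prodFrom1 (suc zero)    f = 𝟙
prodFrom1 (suc (suc a)) f = prodFrom1 (suc a) f ⊗ f (suc a)

factor : ℕ → Ser
factor i = (𝟙 ⊕ (𝟙 ⊖ sS) ⊗ zS ⊗ bracket i) ⊗ geom (sS ⊗ zS ⊗ bracket i)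

term : ℕ → Ser
term a = mono a 0 ⊗ geom (sS ⊗ zS ⊗ bracket a) ⊗ (prodFrom1 a factor ^ˢ 2)

-- RHS = 1 + Σ_{a≥1} term a ; term a is divisible by z^a, so the
-- coefficient of z^n only involves a ≤ n.
rhs : Ser
rhs n k = 𝟙 n k ℤ.+ sumTo n (λ a → if a ≡ᵇ 0 then + 0 else term a n k)

module Submission where

-- Read a Dyck path from left to right as the run of an automaton whose state is the current
-- height h, the height p of the last peak, and the phase: ascending (peak heights still weakly
-- increasing, with the maximal peak height a fixed in advance) or descending. Writing
-- X i = z[i]_z, γ i = 1/(1 - s X i), Π a = ∏_{0<i<a} (1 + (1-s) X i) γ i and ρ a = Π a γ a,
-- the generating function of the completions of every state has a closed form in these
-- series, and the closed forms satisfy the one-step recurrences of the automaton; so, by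
-- induction on the length, they count the completions. The recurrences reduce to
-- (1 + (1-s) X i) γ i = 1 + X i γ i, Π (h+1) = 1 + Σ_{x≤h} X x ρ x and ρ p = Π p + s X p ρ p.
-- In particular everything after a peak at height a in the descending phase contributes ρ a,
-- and the climb from height 1 to the maximum a contributes z^(a-1) Π a. As the maximum of a
-- weakly unimodal sequence is unique, summing z^a Π a ρ a = z^a γ a (Π a)^2 over a gives the
-- right-hand side.

open import Defs

module FiniteSums where

  open import Data.Bool using (if_then_else_)
  open import Data.Nat using (ℕ; zero; suc; _∸_; _≤_; _<_; z≤n; s≤s; _≡ᵇ_)
  open import Data.Nat.Properties as ℕ using (≤-refl; m≤n⇒m≤1+n; n∸n≡0; +-∸-assoc)
  open import Data.Integer using (ℤ; +_; _+_; _*_)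
  open import Data.Integer.Properties as ℤ using (+-identityˡ; +-identityʳ; +-assoc; +-comm; *-comm)
  open import Data.Integer.Tactic.RingSolver using (solve-∀)
  open import Data.Sum using (inj₁; inj₂)
  open import Relation.Binary.PropositionalEquality
  open import Relation.Nullary using (¬_)
  open ≡-Reasoning

  sumTo-cong : ∀ n {f g : ℕ → ℤ} → (∀ i → i ≤ n → f i ≡ g i) → sumTo n f ≡ sumTo n g
  sumTo-cong zero    f≗g = f≗g 0 z≤n
  sumTo-cong (suc n) f≗g = cong₂ _+_ (sumTo-cong n (λ i i≤n → f≗g i (m≤n⇒m≤1+n i≤n))) (f≗g (suc n) ≤-refl)

  sumTo-+ : ∀ n (f g : ℕ → ℤ) → sumTo n (λ i → f i + g i) ≡ sumTo n f + sumTo n g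
  sumTo-+ zero    f g = refl
  sumTo-+ (suc n) f g = begin
    sumTo n (λ i → f i + g i) + (f (suc n) + g (suc n)) ≡⟨ cong (_+ (f (suc n) + g (suc n))) (sumTo-+ n f g) ⟩
    sumTo n f + sumTo n g + (f (suc n) + g (suc n))     ≡⟨ interchange (sumTo n f) (sumTo n g) (f (suc n)) (g (suc n)) ⟩
    sumTo n f + f (suc n) + (sumTo n g + g (suc n))     ∎
    where interchange : ∀ a b c d → a + b + (c + d) ≡ a + c + (b + d)
          interchange = solve-∀

  *-distribˡ-sumTo : ∀ n c (f : ℕ → ℤ) → c * sumTo n f ≡ sumTo n (λ i → c * f i)
  *-distribˡ-sumTo zero    c f = refl
  *-distribˡ-sumTo (suc n) c f =
    trans (ℤ.*-distribˡ-+ c (sumTo n f) (f (suc n))) (cong (_+ c * f (suc n)) (*-distribˡ-sumTo n c f))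

  *-distribʳ-sumTo : ∀ n c (f : ℕ → ℤ) → sumTo n f * c ≡ sumTo n (λ i → f i * c)
  *-distribʳ-sumTo n c f =
    trans (*-comm (sumTo n f) c) (trans (*-distribˡ-sumTo n c f) (sumTo-cong n (λ i _ → *-comm c (f i))))

  sumTo-zero : ∀ n {f : ℕ → ℤ} → (∀ i → i ≤ n → f i ≡ + 0) → sumTo n f ≡ + 0
  sumTo-zero zero    f≡0 = f≡0 0 z≤n
  sumTo-zero (suc n) f≡0 = cong₂ _+_ (sumTo-zero n (λ i i≤n → f≡0 i (m≤n⇒m≤1+n i≤n))) (f≡0 (suc n) ≤-refl)

  sumTo-single : ∀ n a {f : ℕ → ℤ} → a ≤ n → (∀ i → i ≤ n → ¬ i ≡ a → f i ≡ + 0) → sumTo n f ≡ f a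
  sumTo-single n a {f} a≤n f≡0 with ℕ.m≤n⇒m<n∨m≡n a≤n
  sumTo-single (suc n) a {f} _ f≡0 | inj₁ (s≤s a≤n) =
    trans (cong₂ _+_ (sumTo-single n a a≤n (λ i i≤n → f≡0 i (m≤n⇒m≤1+n i≤n)))
                     (f≡0 (suc n) ≤-refl (λ n+1≡a → ℕ.<-irrefl (sym n+1≡a) (s≤s a≤n))))
          (+-identityʳ (f a))
  sumTo-single zero    .zero _ f≡0 | inj₂ refl = refl
  sumTo-single (suc n) .(suc n) {f} _ f≡0 | inj₂ refl =
    trans (cong (_+ f (suc n)) (sumTo-zero n (λ i i≤n →
            f≡0 i (m≤n⇒m≤1+n i≤n) (λ { refl → ℕ.<-irrefl refl (s≤s i≤n) }))))
          (+-identityˡ (f (suc n)))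

  sumTo-single-0 : ∀ n {f : ℕ → ℤ} → (∀ i → suc i ≤ n → f (suc i) ≡ + 0) → sumTo n f ≡ f 0
  sumTo-single-0 zero    f≡0 = refl
  sumTo-single-0 (suc n) f≡0 =
    trans (cong₂ _+_ (sumTo-single-0 n (λ i i<n → f≡0 i (m≤n⇒m≤1+n i<n))) (f≡0 n ≤-refl)) (+-identityʳ _)

  sumTo-truncate : ∀ N n (f : ℕ → ℤ) → n ≤ N → (∀ i → n < i → i ≤ N → f i ≡ + 0) → sumTo N f ≡ sumTo n f
  sumTo-truncate N n f n≤N f≡0 with ℕ.m≤n⇒m<n∨m≡n n≤N
  sumTo-truncate (suc N) n f _ f≡0 | inj₁ (s≤s n≤N) =
    trans (cong₂ _+_ (sumTo-truncate N n f n≤N (λ i n<i i≤N → f≡0 i n<i (m≤n⇒m≤1+n i≤N)))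
                     (f≡0 (suc N) (s≤s n≤N) ≤-refl))
          (+-identityʳ _)
  ... | inj₂ refl = refl

  sumTo-sucˡ : ∀ n (f : ℕ → ℤ) → sumTo (suc n) f ≡ f 0 + sumTo n (λ i → f (suc i))
  sumTo-sucˡ zero    f = refl
  sumTo-sucˡ (suc n) f = trans (cong (_+ f (suc (suc n))) (sumTo-sucˡ n f)) (+-assoc (f 0) _ _)

  sumTo-comm : ∀ n m (f : ℕ → ℕ → ℤ) →
               sumTo n (λ i → sumTo m (λ j → f i j)) ≡ sumTo m (λ j → sumTo n (λ i → f i j))
  sumTo-comm zero    m f = refl
  sumTo-comm (suc n) m f = trans (cong (_+ sumTo m (f (suc n))) (sumTo-comm n m f))
                                 (sym (sumTo-+ m (λ j → sumTo n (λ i → f i j)) (f (suc n))))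

  sumTo-reverse : ∀ n (f : ℕ → ℤ) → sumTo n f ≡ sumTo n (λ i → f (n ∸ i))
  sumTo-reverse zero    f = refl
  sumTo-reverse (suc n) f = begin
    sumTo n f + f (suc n)                   ≡⟨ cong (_+ f (suc n)) (sumTo-reverse n f) ⟩
    sumTo n (λ i → f (n ∸ i)) + f (suc n)   ≡⟨ +-comm (sumTo n (λ i → f (n ∸ i))) (f (suc n)) ⟩
    f (suc n) + sumTo n (λ i → f (n ∸ i))   ≡⟨ sym (sumTo-sucˡ n (λ i → f (suc n ∸ i))) ⟩
    sumTo (suc n) (λ i → f (suc n ∸ i))     ∎

  sumTo-reverse₂ : ∀ n (f : ℕ → ℕ → ℤ) → sumTo n (λ i → f i (n ∸ i)) ≡ sumTo n (λ i → f (n ∸ i) i)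
  sumTo-reverse₂ n f =
    trans (sumTo-reverse n _) (sumTo-cong n (λ i i≤n → cong (f (n ∸ i)) (ℕ.m∸[m∸n]≡n i≤n)))

  -- Both sides sum ψ over the triples (i', t, c) with i' + t + c = n.
  sumTo-triangle : ∀ n (ψ : ℕ → ℕ → ℕ → ℤ) →
    sumTo n (λ i → sumTo i (λ i' → ψ i' (i ∸ i') (n ∸ i))) ≡
    sumTo n (λ i' → sumTo (n ∸ i') (λ t → ψ i' t (n ∸ i' ∸ t)))
  sumTo-triangle zero    ψ = refl
  sumTo-triangle (suc n) ψ = begin
      sumTo n (λ i → sumTo i (λ i' → ψ i' (i ∸ i') (suc n ∸ i))) + sumTo (suc n) (λ i' → ψ i' (suc n ∸ i') (n ∸ n))
    ≡⟨ cong₂ _+_ (trans (sumTo-cong n (λ i i≤n → cong (λ c → sumTo i (λ i' → ψ i' (i ∸ i') c)) (+-∸-assoc 1 i≤n)))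
                        (sumTo-triangle n ψ⁺))
                 (sumTo-cong (suc n) (λ i' _ → cong (ψ i' (suc n ∸ i')) (n∸n≡0 n))) ⟩
      sumTo n (λ i' → sumTo (n ∸ i') (λ t → ψ⁺ i' t (n ∸ i' ∸ t))) + (sumTo n (λ i' → ψ i' (suc n ∸ i') 0) + ψ (suc n) (n ∸ n) 0)
    ≡⟨ sym (+-assoc (sumTo n _) (sumTo n _) _) ⟩
      sumTo n (λ i' → sumTo (n ∸ i') (λ t → ψ⁺ i' t (n ∸ i' ∸ t))) + sumTo n (λ i' → ψ i' (suc n ∸ i') 0) + ψ (suc n) (n ∸ n) 0
    ≡⟨ cong₂ _+_ (trans (sym (sumTo-+ n _ _)) (sumTo-cong n extend)) (last (n ∸ n) (n∸n≡0 n)) ⟩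
      sumTo (suc n) (λ i' → sumTo (suc n ∸ i') (λ t → ψ i' t (suc n ∸ i' ∸ t)))
    ∎
    where
    ψ⁺ : ℕ → ℕ → ℕ → ℤ
    ψ⁺ a b c = ψ a b (suc c)
    last : ∀ c → c ≡ 0 → ψ (suc n) c 0 ≡ sumTo c (λ t → ψ (suc n) t (c ∸ t))
    last .0 refl = refl
    extend : ∀ i' → i' ≤ n → sumTo (n ∸ i') (λ t → ψ⁺ i' t (n ∸ i' ∸ t)) + ψ i' (suc n ∸ i') 0
                            ≡ sumTo (suc n ∸ i') (λ t → ψ i' t (suc n ∸ i' ∸ t))
    extend i' i'≤n rewrite +-∸-assoc 1 i'≤n =
      cong₂ _+_ (sumTo-cong (n ∸ i') (λ t t≤ → cong (ψ i' t) (sym (+-∸-assoc 1 t≤))))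
                (cong (ψ i' (suc (n ∸ i'))) (sym (n∸n≡0 (n ∸ i'))))

  sumTo-if-0 : ∀ N x (f : ℕ → ℤ) →
               sumTo N (λ a → if a ≡ᵇ 0 then x else f a) ≡ x + sumTo N (λ a → if a ≡ᵇ 0 then + 0 else f a)
  sumTo-if-0 zero    x f = sym (+-identityʳ x)
  sumTo-if-0 (suc N) x f = trans (cong (_+ f (suc N)) (sumTo-if-0 N x f)) (+-assoc x _ (f (suc N)))

module SeriesRing where

  open FiniteSums
  open import Data.Nat using (_∸_)
  open import Data.Integer using (+_; _+_; _*_; -_)
  import Data.Integer.Properties as ℤ
  open import Data.Product using (_,_)
  open import Level using (0ℓ)
  open import Algebra.Bundles using (CommutativeRing)
  open import Relation.Binary.PropositionalEquality using (_≡_; refl; cong; cong₂; trans; sym; module ≡-Reasoning)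

  infix 4 _≈_
  record _≈_ (F G : Ser) : Set where
    constructor mk≈
    field coeff : ∀ n k → F n k ≡ G n k
  open _≈_ public

  0ˢ : Ser
  0ˢ _ _ = + 0

  ⊝_ : Ser → Ser
  (⊝ F) n k = - F n k

  ≈-refl : ∀ {F} → F ≈ F
  ≈-refl = mk≈ (λ _ _ → refl)

  ≈-reflexive : ∀ {F G} → F ≡ G → F ≈ G
  ≈-reflexive refl = ≈-refl

  ≈-sym : ∀ {F G} → F ≈ G → G ≈ F
  ≈-sym F≈G = mk≈ (λ n k → sym (coeff F≈G n k))

  ≈-trans : ∀ {F G H} → F ≈ G → G ≈ H → F ≈ H
  ≈-trans F≈G G≈H = mk≈ (λ n k → trans (coeff F≈G n k) (coeff G≈H n k))

  ⊕-cong : ∀ {F F' G G'} → F ≈ F' → G ≈ G' → F ⊕ G ≈ F' ⊕ G'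
  ⊕-cong F≈F' G≈G' = mk≈ (λ n k → cong₂ _+_ (coeff F≈F' n k) (coeff G≈G' n k))

  ⊝-cong : ∀ {F F'} → F ≈ F' → ⊝ F ≈ ⊝ F'
  ⊝-cong F≈F' = mk≈ (λ n k → cong -_ (coeff F≈F' n k))

  ⊗-cong : ∀ {F F' G G'} → F ≈ F' → G ≈ G' → F ⊗ G ≈ F' ⊗ G'
  ⊗-cong F≈F' G≈G' = mk≈ (λ n k → sumTo-cong n (λ i _ → sumTo-cong k (λ j _ →
    cong₂ _*_ (coeff F≈F' i j) (coeff G≈G' (n ∸ i) (k ∸ j)))))

  ⊕-assoc : ∀ F G H → (F ⊕ G) ⊕ H ≈ F ⊕ (G ⊕ H)
  ⊕-assoc F G H = mk≈ (λ n k → ℤ.+-assoc (F n k) (G n k) (H n k))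

  ⊕-comm : ∀ F G → F ⊕ G ≈ G ⊕ F
  ⊕-comm F G = mk≈ (λ n k → ℤ.+-comm (F n k) (G n k))

  ⊕-identityˡ : ∀ F → 0ˢ ⊕ F ≈ F
  ⊕-identityˡ F = mk≈ (λ n k → ℤ.+-identityˡ (F n k))

  ⊕-identityʳ : ∀ F → F ⊕ 0ˢ ≈ F
  ⊕-identityʳ F = mk≈ (λ n k → ℤ.+-identityʳ (F n k))

  ⊕-inverseˡ : ∀ F → (⊝ F) ⊕ F ≈ 0ˢ
  ⊕-inverseˡ F = mk≈ (λ n k → ℤ.+-inverseˡ (F n k))

  ⊕-inverseʳ : ∀ F → F ⊕ (⊝ F) ≈ 0ˢ
  ⊕-inverseʳ F = mk≈ (λ n k → ℤ.+-inverseʳ (F n k))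

  ⊗-comm : ∀ F G → F ⊗ G ≈ G ⊗ F
  ⊗-comm F G = mk≈ λ n k → begin
      sumTo n (λ i → sumTo k (λ j → F i j * G (n ∸ i) (k ∸ j)))
    ≡⟨ sumTo-reverse₂ n (λ i i' → sumTo k (λ j → F i j * G i' (k ∸ j))) ⟩
      sumTo n (λ i → sumTo k (λ j → F (n ∸ i) j * G i (k ∸ j)))
    ≡⟨ sumTo-cong n (λ i _ → sumTo-reverse₂ k (λ j j' → F (n ∸ i) j * G i j')) ⟩
      sumTo n (λ i → sumTo k (λ j → F (n ∸ i) (k ∸ j) * G i j))
    ≡⟨ sumTo-cong n (λ i _ → sumTo-cong k (λ j _ → ℤ.*-comm (F (n ∸ i) (k ∸ j)) (G i j))) ⟩
      sumTo n (λ i → sumTo k (λ j → G i j * F (n ∸ i) (k ∸ j)))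
    ∎
    where open ≡-Reasoning

  ⊗-distribʳ-⊕ : ∀ H F G → (F ⊕ G) ⊗ H ≈ F ⊗ H ⊕ G ⊗ H
  ⊗-distribʳ-⊕ H F G = mk≈ λ n k →
    trans (sumTo-cong n (λ i _ →
            trans (sumTo-cong k (λ j _ → ℤ.*-distribʳ-+ (H (n ∸ i) (k ∸ j)) (F i j) (G i j)))
                  (sumTo-+ k _ _)))
          (sumTo-+ n _ _)

  ⊗-identityˡ : ∀ F → 𝟙 ⊗ F ≈ F
  ⊗-identityˡ F = mk≈ λ n k →
    trans (sumTo-single-0 n (λ _ _ → sumTo-zero k (λ _ _ → refl)))
          (trans (sumTo-single-0 k (λ _ _ → refl)) (ℤ.*-identityˡ (F n k)))

  -- Both sides sum F i' j' * G t t' * H c c' over i' + t + c = n and j' + t' + c' = k.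
  ⊗-assoc : ∀ F G H → (F ⊗ G) ⊗ H ≈ F ⊗ (G ⊗ H)
  ⊗-assoc F G H = mk≈ λ n k → begin
      sumTo n (λ i → sumTo k (λ j → sumTo i (λ i' → sumTo j (λ j' → F i' j' * G (i ∸ i') (j ∸ j'))) * H (n ∸ i) (k ∸ j)))
    ≡⟨ sumTo-cong n (λ i _ → sumTo-cong k (λ j _ →
         trans (*-distribʳ-sumTo i (H (n ∸ i) (k ∸ j)) _)
               (sumTo-cong i (λ i' _ → *-distribʳ-sumTo j (H (n ∸ i) (k ∸ j)) _)))) ⟩
      sumTo n (λ i → sumTo k (λ j → sumTo i (λ i' → sumTo j (λ j' → F i' j' * G (i ∸ i') (j ∸ j') * H (n ∸ i) (k ∸ j)))))
    ≡⟨ sumTo-cong n (λ i _ → sumTo-comm k i _) ⟩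
      sumTo n (λ i → sumTo i (λ i' → sumTo k (λ j → sumTo j (λ j' → F i' j' * G (i ∸ i') (j ∸ j') * H (n ∸ i) (k ∸ j)))))
    ≡⟨ sumTo-triangle n (λ i' t c → sumTo k (λ j → sumTo j (λ j' → F i' j' * G t (j ∸ j') * H c (k ∸ j)))) ⟩
      sumTo n (λ i' → sumTo (n ∸ i') (λ t → sumTo k (λ j → sumTo j (λ j' → F i' j' * G t (j ∸ j') * H (n ∸ i' ∸ t) (k ∸ j)))))
    ≡⟨ sumTo-cong n (λ i' _ → sumTo-cong (n ∸ i') (λ t _ → sumTo-triangle k (λ j' t' c → F i' j' * G t t' * H (n ∸ i' ∸ t) c))) ⟩
      sumTo n (λ i' → sumTo (n ∸ i') (λ t → sumTo k (λ j' → sumTo (k ∸ j') (λ t' → F i' j' * G t t' * H (n ∸ i' ∸ t) (k ∸ j' ∸ t')))))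
    ≡⟨ sumTo-cong n (λ i' _ → sym (sumTo-comm k (n ∸ i') _)) ⟩
      sumTo n (λ i' → sumTo k (λ j' → sumTo (n ∸ i') (λ t → sumTo (k ∸ j') (λ t' → F i' j' * G t t' * H (n ∸ i' ∸ t) (k ∸ j' ∸ t')))))
    ≡⟨ sumTo-cong n (λ i' _ → sumTo-cong k (λ j' _ → sumTo-cong (n ∸ i') (λ t _ → sumTo-cong (k ∸ j') (λ t' _ →
         ℤ.*-assoc (F i' j') (G t t') (H (n ∸ i' ∸ t) (k ∸ j' ∸ t')))))) ⟩
      sumTo n (λ i' → sumTo k (λ j' → sumTo (n ∸ i') (λ t → sumTo (k ∸ j') (λ t' → F i' j' * (G t t' * H (n ∸ i' ∸ t) (k ∸ j' ∸ t'))))))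
    ≡⟨ sumTo-cong n (λ i' _ → sumTo-cong k (λ j' _ →
         sym (trans (*-distribˡ-sumTo (n ∸ i') (F i' j') _)
                    (sumTo-cong (n ∸ i') (λ t _ → *-distribˡ-sumTo (k ∸ j') (F i' j') _))))) ⟩
      sumTo n (λ i' → sumTo k (λ j' → F i' j' * sumTo (n ∸ i') (λ t → sumTo (k ∸ j') (λ t' → G t t' * H (n ∸ i' ∸ t) (k ∸ j' ∸ t')))))
    ∎
    where open ≡-Reasoning

  ⊗-identityʳ : ∀ F → F ⊗ 𝟙 ≈ F
  ⊗-identityʳ F = ≈-trans (⊗-comm F 𝟙) (⊗-identityˡ F)

  ⊗-distribˡ-⊕ : ∀ F G H → F ⊗ (G ⊕ H) ≈ F ⊗ G ⊕ F ⊗ H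
  ⊗-distribˡ-⊕ F G H = ≈-trans (⊗-comm F (G ⊕ H))
    (≈-trans (⊗-distribʳ-⊕ F G H) (⊕-cong (⊗-comm G F) (⊗-comm H F)))

  series-commutativeRing : CommutativeRing 0ℓ 0ℓ
  series-commutativeRing = record
    { Carrier = Ser ; _≈_ = _≈_ ; _+_ = _⊕_ ; _*_ = _⊗_ ; -_ = ⊝_ ; 0# = 0ˢ ; 1# = 𝟙
    ; isCommutativeRing = record
      { isRing = record
        { +-isAbelianGroup = record
          { isGroup = record
            { isMonoid = record
              { isSemigroup = record
                { isMagma = record
                  { isEquivalence = record { refl = ≈-refl ; sym = ≈-sym ; trans = ≈-trans }
                  ; ∙-cong = ⊕-cong }
                ; assoc = ⊕-assoc }
              ; identity = ⊕-identityˡ , ⊕-identityʳ }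
            ; inverse = ⊕-inverseˡ , ⊕-inverseʳ
            ; ⁻¹-cong = ⊝-cong }
          ; comm = ⊕-comm }
        ; *-cong = ⊗-cong
        ; *-assoc = ⊗-assoc
        ; *-identity = ⊗-identityˡ , ⊗-identityʳ
        ; distrib = ⊗-distribˡ-⊕ , ⊗-distribʳ-⊕ }
      ; *-comm = ⊗-comm }
    }

  ⊗-congˡ : ∀ F {G G'} → G ≈ G' → F ⊗ G ≈ F ⊗ G'
  ⊗-congˡ F G≈G' = ⊗-cong (≈-refl {F}) G≈G'

  ⊗-congʳ : ∀ G {F F'} → F ≈ F' → F ⊗ G ≈ F' ⊗ G
  ⊗-congʳ G F≈F' = ⊗-cong F≈F' (≈-refl {G})

  ⊕-congˡ : ∀ F {G G'} → G ≈ G' → F ⊕ G ≈ F ⊕ G'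
  ⊕-congˡ F G≈G' = ⊕-cong (≈-refl {F}) G≈G'

  ⊕-congʳ : ∀ G {F F'} → F ≈ F' → F ⊕ G ≈ F' ⊕ G
  ⊕-congʳ G F≈F' = ⊕-cong F≈F' (≈-refl {G})

  open import Algebra.Solver.Ring.NaturalCoefficients.Default
    (CommutativeRing.commutativeSemiring series-commutativeRing) public
    using (solve; _:=_; _:+_; _:*_; con)

module BooleanTests where

  open import Data.Bool using (true; false)
  open import Data.Nat using (ℕ; _≤_; _<_; _≤ᵇ_; _<ᵇ_; _≡ᵇ_)
  open import Data.Nat.Properties as ℕ using (≤ᵇ-reflects-≤; <ᵇ-reflects-<; ≰⇒>)
  open import Relation.Binary.PropositionalEquality using (_≡_; refl)
  open import Relation.Nullary using (¬_; contradiction)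
  open import Relation.Nullary.Reflects using (Reflects; ofʸ; ofⁿ; fromEquivalence)

  module _ {P : Set} where

    reflects-true : ∀ {b} → Reflects P b → P → b ≡ true
    reflects-true (ofʸ _)  _ = refl
    reflects-true (ofⁿ ¬p) p = contradiction p ¬p

    reflects-false : ∀ {b} → Reflects P b → ¬ P → b ≡ false
    reflects-false (ofʸ p) ¬p = contradiction p ¬p
    reflects-false (ofⁿ _) _  = refl

    reflects-sound : ∀ {b} → Reflects P b → b ≡ true → P
    reflects-sound (ofʸ p) _ = p

    reflects-refute : ∀ {b} → Reflects P b → b ≡ false → ¬ P
    reflects-refute (ofⁿ ¬p) _ = ¬p

  ≡ᵇ-reflects-≡ : ∀ m n → Reflects (m ≡ n) (m ≡ᵇ n)
  ≡ᵇ-reflects-≡ m n = fromEquivalence (ℕ.≡ᵇ⇒≡ m n) (ℕ.≡⇒≡ᵇ m n)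

  module _ {m n : ℕ} where

    ≤⇒≤ᵇ≡true : m ≤ n → (m ≤ᵇ n) ≡ true
    ≤⇒≤ᵇ≡true = reflects-true (≤ᵇ-reflects-≤ m n)

    ≰⇒≤ᵇ≡false : ¬ m ≤ n → (m ≤ᵇ n) ≡ false
    ≰⇒≤ᵇ≡false = reflects-false (≤ᵇ-reflects-≤ m n)

    <⇒<ᵇ≡true : m < n → (m <ᵇ n) ≡ true
    <⇒<ᵇ≡true = reflects-true (<ᵇ-reflects-< m n)

    ≮⇒<ᵇ≡false : ¬ m < n → (m <ᵇ n) ≡ false
    ≮⇒<ᵇ≡false = reflects-false (<ᵇ-reflects-< m n)

    ≡⇒≡ᵇ≡true : m ≡ n → (m ≡ᵇ n) ≡ true
    ≡⇒≡ᵇ≡true = reflects-true (≡ᵇ-reflects-≡ m n)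

    ≢⇒≡ᵇ≡false : ¬ m ≡ n → (m ≡ᵇ n) ≡ false
    ≢⇒≡ᵇ≡false = reflects-false (≡ᵇ-reflects-≡ m n)

  ≤ᵇ≡true⇒≤ : ∀ m n → (m ≤ᵇ n) ≡ true → m ≤ n
  ≤ᵇ≡true⇒≤ m n = reflects-sound (≤ᵇ-reflects-≤ m n)

  ≤ᵇ≡false⇒> : ∀ m n → (m ≤ᵇ n) ≡ false → n < m
  ≤ᵇ≡false⇒> m n e = ≰⇒> (reflects-refute (≤ᵇ-reflects-≤ m n) e)

  <ᵇ≡true⇒< : ∀ m n → (m <ᵇ n) ≡ true → m < n
  <ᵇ≡true⇒< m n = reflects-sound (<ᵇ-reflects-< m n)

  ≡ᵇ≡true⇒≡ : ∀ m n → (m ≡ᵇ n) ≡ true → m ≡ n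
  ≡ᵇ≡true⇒≡ m n = reflects-sound (≡ᵇ-reflects-≡ m n)

module Coefficients where

  open FiniteSums
  open SeriesRing
  open BooleanTests
  open import Data.Bool using (if_then_else_; _∧_)
  open import Data.Nat using (ℕ; zero; suc; _∸_; _<_; z≤n; s≤s; _≡ᵇ_)
  import Data.Nat.Properties as ℕ
  open import Data.Integer using (+_; _*_)
  import Data.Integer.Properties as ℤ
  open import Relation.Binary.PropositionalEquality using (_≡_; refl; cong; trans; sym)

  zS⊗-zero : ∀ F k → (zS ⊗ F) 0 k ≡ + 0
  zS⊗-zero F k = sumTo-zero k (λ _ _ → refl)

  zS⊗-suc : ∀ F n k → (zS ⊗ F) (suc n) k ≡ F n k
  zS⊗-suc F n k =
    trans (sumTo-single (suc n) 1 (s≤s z≤n) (λ i _ i≢1 → sumTo-zero k (λ j _ →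
            cong (λ b → (if b ∧ (j ≡ᵇ 0) then + 1 else + 0) * F (suc n ∸ i) (k ∸ j)) (≢⇒≡ᵇ≡false i≢1))))
          (trans (sumTo-single-0 k (λ _ _ → refl)) (ℤ.*-identityˡ (F n k)))

  sS⊗-zero : ∀ F n → (sS ⊗ F) n 0 ≡ + 0
  sS⊗-zero F n = sumTo-single-0 n (λ _ _ → refl)

  sS⊗-suc : ∀ F n k → (sS ⊗ F) n (suc k) ≡ F n k
  sS⊗-suc F n k =
    trans (sumTo-single-0 n (λ _ _ → sumTo-zero (suc k) (λ _ _ → refl)))
          (trans (sumTo-single (suc k) 1 (s≤s z≤n) (λ j _ j≢1 →
                   cong (λ b → (if b then + 1 else + 0) * F n (suc k ∸ j)) (≢⇒≡ᵇ≡false j≢1)))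
                 (ℤ.*-identityˡ (F n k)))

  ⊗-zeroˡ : ∀ F → 0ˢ ⊗ F ≈ 0ˢ
  ⊗-zeroˡ F = mk≈ (λ n k → sumTo-zero n (λ _ _ → sumTo-zero k (λ _ _ → refl)))

  ⊗-zeroʳ : ∀ F → F ⊗ 0ˢ ≈ 0ˢ
  ⊗-zeroʳ F = ≈-trans (⊗-comm F 0ˢ) (⊗-zeroˡ F)

  zS⊗mono : ∀ a → zS ⊗ mono a 0 ≈ mono (suc a) 0
  zS⊗mono a = mk≈ λ where
    zero    k → zS⊗-zero (mono a 0) k
    (suc n) k → zS⊗-suc (mono a 0) n k

  mono≈zS^ : ∀ e → mono e 0 ≈ zS ^ˢ e
  mono≈zS^ zero    = ≈-refl
  mono≈zS^ (suc e) = ≈-trans (≈-sym (zS⊗mono e)) (⊗-congˡ zS (mono≈zS^ e))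

  VanishesBelow : ℕ → Ser → Set
  VanishesBelow a F = ∀ n k → n < a → F n k ≡ + 0

  VanishesBelow-⊗ : ∀ a F G → VanishesBelow a F → VanishesBelow a (F ⊗ G)
  VanishesBelow-⊗ a F G F₀ n k n<a = sumTo-zero n (λ i i≤n → sumTo-zero k (λ j _ →
    cong (_* G (n ∸ i) (k ∸ j)) (F₀ i j (ℕ.≤-<-trans i≤n n<a))))

  VanishesBelow-resp-≈ : ∀ a {F G} → F ≈ G → VanishesBelow a F → VanishesBelow a G
  VanishesBelow-resp-≈ a F≈G F₀ n k n<a = trans (sym (coeff F≈G n k)) (F₀ n k n<a)

  mono-vanishesBelow : ∀ a → VanishesBelow a (mono a 0)
  mono-vanishesBelow a n k n<a =
    cong (λ b → if b ∧ (k ≡ᵇ 0) then + 1 else + 0) (≢⇒≡ᵇ≡false (λ n≡a → ℕ.<-irrefl n≡a n<a))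

  zS⊗-vanishesBelow : ∀ F → VanishesBelow 1 (zS ⊗ F)
  zS⊗-vanishesBelow F zero    k _         = zS⊗-zero F k
  zS⊗-vanishesBelow F (suc n) k (s≤s ())

module GeometricSeries where

  open FiniteSums
  open SeriesRing
  open Coefficients
  open import Data.Nat using (ℕ; zero; suc; _∸_; _≤_; _<_; z≤n; s≤s)
  import Data.Nat.Properties as ℕ
  open import Data.Integer using (ℤ; +_; _+_; _*_)
  import Data.Integer.Properties as ℤ
  open import Relation.Binary.PropositionalEquality using (_≡_; cong; trans; sym; module ≡-Reasoning)

  ^ˢ-vanishesBelow : ∀ Y → VanishesBelow 1 Y → ∀ m → VanishesBelow m (Y ^ˢ m)
  ^ˢ-vanishesBelow Y Y₀ (suc m) n k n<1+m = sumTo-zero n term≡0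
    where
    term≡0 : ∀ i → i ≤ n → sumTo k (λ j → Y i j * (Y ^ˢ m) (n ∸ i) (k ∸ j)) ≡ + 0
    term≡0 zero    _ = sumTo-zero k (λ j _ → cong (_* (Y ^ˢ m) n (k ∸ j)) (Y₀ 0 j (s≤s z≤n)))
    term≡0 (suc i) i<n = sumTo-zero k (λ j _ →
      trans (cong (Y (suc i) j *_) (^ˢ-vanishesBelow Y Y₀ m (n ∸ suc i) (k ∸ j) n-i-1<m)) (ℤ.*-zeroʳ (Y (suc i) j)))
      where n-i-1<m : n ∸ suc i < m
            n-i-1<m = ℕ.<-≤-trans (ℕ.∸-monoʳ-< {n} {suc i} {0} (s≤s z≤n) i<n) (ℕ.≤-pred n<1+m)

  -- Only the powers Y^m with m ≤ n reach z^n, so the truncation in geom is harmless.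
  geom-unfold : ∀ Y → VanishesBelow 1 Y → geom Y ≈ 𝟙 ⊕ Y ⊗ geom Y
  geom-unfold Y Y₀ = mk≈ unfold
    where
    Y⊗geom : ∀ n k → (Y ⊗ geom Y) n k ≡ sumTo n (λ m → (Y ^ˢ suc m) n k)
    Y⊗geom n k =
      trans (sumTo-cong n (λ i _ → sumTo-cong k (λ j _ → cong (Y i j *_)
              (sym (sumTo-truncate n (n ∸ i) _ (ℕ.m∸n≤m n i)
                     (λ m n-i<m _ → ^ˢ-vanishesBelow Y Y₀ m (n ∸ i) (k ∸ j) n-i<m))))))
      (trans (sumTo-cong n (λ i _ → sumTo-cong k (λ j _ → *-distribˡ-sumTo n (Y i j) _)))
      (trans (sumTo-cong n (λ i _ → sumTo-comm k n _)) (sumTo-comm n n _)))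
    unfold : ∀ n k → geom Y n k ≡ (𝟙 ⊕ Y ⊗ geom Y) n k
    unfold zero    k = sym (trans (cong (λ x → 𝟙 zero k + x) (trans (Y⊗geom 0 k) (^ˢ-vanishesBelow Y Y₀ 1 0 k (s≤s z≤n))))
                              (ℤ.+-identityʳ _))
    unfold (suc n) k = trans (sumTo-sucˡ n (λ m → (Y ^ˢ m) (suc n) k)) (cong (λ x → 𝟙 (suc n) k + x) (sym (begin
        (Y ⊗ geom Y) (suc n) k
      ≡⟨ Y⊗geom (suc n) k ⟩
        sumTo n (λ m → (Y ^ˢ suc m) (suc n) k) + (Y ^ˢ suc (suc n)) (suc n) k
      ≡⟨ cong (λ x → sumTo n (λ m → (Y ^ˢ suc m) (suc n) k) + x) (^ˢ-vanishesBelow Y Y₀ (suc (suc n)) (suc n) k ℕ.≤-refl) ⟩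
        sumTo n (λ m → (Y ^ˢ suc m) (suc n) k) + (+ 0)
      ≡⟨ ℤ.+-identityʳ _ ⟩
        sumTo n (λ m → (Y ^ˢ suc m) (suc n) k)
      ∎)))
      where open ≡-Reasoning

module RightHandSide where

  open SeriesRing
  open Coefficients
  open GeometricSeries
  open import Data.Nat using (ℕ; zero; suc)
  open import Algebra.Bundles using (CommutativeRing)
  open import Relation.Binary.Reasoning.Setoid (CommutativeRing.setoid series-commutativeRing)

  X : ℕ → Ser
  X i = zS ⊗ bracket i

  γ : ℕ → Ser
  γ i = geom (sS ⊗ zS ⊗ bracket i)

  Π : ℕ → Ser
  Π a = prodFrom1 a factor

  ρ : ℕ → Ser
  ρ a = Π a ⊗ γ a

  Σ-Xρ : ℕ → Ser
  Σ-Xρ zero    = 0ˢ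
  Σ-Xρ (suc h) = Σ-Xρ h ⊕ X (suc h) ⊗ ρ (suc h)

  bracket-suc : ∀ j → bracket (suc j) ≈ 𝟙 ⊕ zS ⊗ bracket j
  bracket-suc zero    = ≈-trans (⊕-comm 0ˢ 𝟙) (⊕-congˡ 𝟙 (≈-sym (⊗-zeroʳ zS)))
  bracket-suc (suc j) = begin
    bracket (suc j) ⊕ mono (suc j) 0          ≈⟨ ⊕-cong (bracket-suc j) (≈-sym (zS⊗mono j)) ⟩
    𝟙 ⊕ zS ⊗ bracket j ⊕ zS ⊗ mono j 0        ≈⟨ ⊕-assoc 𝟙 _ _ ⟩
    𝟙 ⊕ (zS ⊗ bracket j ⊕ zS ⊗ mono j 0)      ≈⟨ ⊕-congˡ 𝟙 (≈-sym (⊗-distribˡ-⊕ zS (bracket j) (mono j 0))) ⟩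
    𝟙 ⊕ zS ⊗ (bracket j ⊕ mono j 0)           ∎

  X-suc : ∀ j → X (suc j) ≈ zS ⊕ zS ⊗ X j
  X-suc j = begin
    zS ⊗ bracket (suc j)          ≈⟨ ⊗-congˡ zS (bracket-suc j) ⟩
    zS ⊗ (𝟙 ⊕ zS ⊗ bracket j)     ≈⟨ ⊗-distribˡ-⊕ zS 𝟙 (zS ⊗ bracket j) ⟩
    zS ⊗ 𝟙 ⊕ zS ⊗ X j             ≈⟨ ⊕-congʳ (zS ⊗ X j) (⊗-identityʳ zS) ⟩
    zS ⊕ zS ⊗ X j                 ∎

  X-1 : X 1 ≈ zS
  X-1 = ≈-trans (X-suc 0) (≈-trans (⊕-congˡ zS (≈-trans (⊗-congˡ zS (⊗-zeroʳ zS)) (⊗-zeroʳ zS))) (⊕-identityʳ zS))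

  γ-unfold : ∀ j → γ j ≈ 𝟙 ⊕ sS ⊗ X j ⊗ γ j
  γ-unfold j = ≈-trans (geom-unfold (sS ⊗ zS ⊗ bracket j) sz[j]-vanishes)
                       (⊕-congˡ 𝟙 (⊗-congʳ (γ j) (⊗-assoc sS zS (bracket j))))
    where
    swap : ∀ s z b → z ⊗ (s ⊗ b) ≈ s ⊗ z ⊗ b
    swap = solve 3 (λ s z b → z :* (s :* b) := s :* z :* b) ≈-refl
    sz[j]-vanishes : VanishesBelow 1 (sS ⊗ zS ⊗ bracket j)
    sz[j]-vanishes = VanishesBelow-resp-≈ 1 (swap sS zS (bracket j)) (zS⊗-vanishesBelow (sS ⊗ bracket j))

  factor≈ : ∀ i → factor i ≈ 𝟙 ⊕ X i ⊗ γ i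
  factor≈ i = begin
      (𝟙 ⊕ (𝟙 ⊕ ⊝ sS) ⊗ zS ⊗ bracket i) ⊗ γ i
    ≈⟨ expand (⊝ sS) zS (bracket i) (γ i) ⟩
      γ i ⊕ X i ⊗ γ i ⊕ (⊝ sS) ⊗ X i ⊗ γ i
    ≈⟨ ⊕-cong (⊕-congʳ (X i ⊗ γ i) (γ-unfold i)) -sXγ≈ ⟩
      𝟙 ⊕ sXγ ⊕ X i ⊗ γ i ⊕ ⊝ sXγ
    ≈⟨ regroup 𝟙 sXγ (X i ⊗ γ i) (⊝ sXγ) ⟩
      𝟙 ⊕ X i ⊗ γ i ⊕ (sXγ ⊕ ⊝ sXγ)
    ≈⟨ ⊕-congˡ (𝟙 ⊕ X i ⊗ γ i) (⊕-inverseʳ sXγ) ⟩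
      𝟙 ⊕ X i ⊗ γ i ⊕ 0ˢ
    ≈⟨ ⊕-identityʳ (𝟙 ⊕ X i ⊗ γ i) ⟩
      𝟙 ⊕ X i ⊗ γ i
    ∎
    where
    open import Algebra.Properties.Ring (CommutativeRing.ring series-commutativeRing) using (-‿distribˡ-*)
    expand : ∀ n z b g → (𝟙 ⊕ (𝟙 ⊕ n) ⊗ z ⊗ b) ⊗ g ≈ g ⊕ z ⊗ b ⊗ g ⊕ n ⊗ (z ⊗ b) ⊗ g
    expand = solve 4 (λ n z b g → (con 1 :+ (con 1 :+ n) :* z :* b) :* g := g :+ z :* b :* g :+ n :* (z :* b) :* g) ≈-refl
    regroup : ∀ o a b c → o ⊕ a ⊕ b ⊕ c ≈ o ⊕ b ⊕ (a ⊕ c)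
    regroup = solve 4 (λ o a b c → o :+ a :+ b :+ c := o :+ b :+ (a :+ c)) ≈-refl
    sXγ : Ser
    sXγ = sS ⊗ X i ⊗ γ i
    -sXγ≈ : (⊝ sS) ⊗ X i ⊗ γ i ≈ ⊝ sXγ
    -sXγ≈ = ≈-sym (≈-trans (-‿distribˡ-* (sS ⊗ X i) (γ i)) (⊗-congʳ (γ i) (-‿distribˡ-* sS (X i))))

  ⊗-distrib-𝟙⊕ : ∀ F Y G → F ⊗ (𝟙 ⊕ Y ⊗ G) ≈ F ⊕ Y ⊗ (F ⊗ G)
  ⊗-distrib-𝟙⊕ = solve 3 (λ F Y G → F :* (con 1 :+ Y :* G) := F :+ Y :* (F :* G)) ≈-refl

  Π-suc≈ : ∀ h → Π (suc h) ≈ 𝟙 ⊕ Σ-Xρ h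
  Π-suc≈ zero    = ≈-sym (⊕-identityʳ 𝟙)
  Π-suc≈ (suc h) = begin
    Π (suc h) ⊗ factor (suc h)                 ≈⟨ ⊗-congˡ (Π (suc h)) (factor≈ (suc h)) ⟩
    Π (suc h) ⊗ (𝟙 ⊕ X (suc h) ⊗ γ (suc h))    ≈⟨ ⊗-distrib-𝟙⊕ (Π (suc h)) (X (suc h)) (γ (suc h)) ⟩
    Π (suc h) ⊕ X (suc h) ⊗ ρ (suc h)          ≈⟨ ⊕-congʳ (X (suc h) ⊗ ρ (suc h)) (Π-suc≈ h) ⟩
    𝟙 ⊕ Σ-Xρ h ⊕ X (suc h) ⊗ ρ (suc h)         ≈⟨ ⊕-assoc 𝟙 (Σ-Xρ h) _ ⟩
    𝟙 ⊕ Σ-Xρ (suc h)                           ∎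

  ρ-unfold : ∀ p → ρ p ≈ Π p ⊕ sS ⊗ X p ⊗ ρ p
  ρ-unfold p = begin
    Π p ⊗ γ p                           ≈⟨ ⊗-congˡ (Π p) (γ-unfold p) ⟩
    Π p ⊗ (𝟙 ⊕ sS ⊗ X p ⊗ γ p)          ≈⟨ ⊗-distrib-𝟙⊕ (Π p) (sS ⊗ X p) (γ p) ⟩
    Π p ⊕ sS ⊗ X p ⊗ ρ p                ∎

  term-vanishesBelow : ∀ a → VanishesBelow a (term a)
  term-vanishesBelow a =
    VanishesBelow-⊗ a _ (prodFrom1 a factor ^ˢ 2) (VanishesBelow-⊗ a (mono a 0) (γ a) (mono-vanishesBelow a))

module WordCounting where

  open FiniteSums
  open import Data.Bool using (Bool; true; false; _∧_)
  import Data.Bool.Properties as Bool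
  open import Data.Nat using (ℕ; zero; suc; _+_)
  open import Data.Nat.Tactic.RingSolver using (solve-∀)
  open import Data.Integer as ℤ using (ℤ; +_)
  import Data.Integer.Properties as ℤ
  open import Data.List using (List; []; _∷_; length; filterᵇ; concatMap)
  open import Relation.Binary.PropositionalEquality using (_≡_; refl; cong; cong₂; trans; sym; module ≡-Reasoning)
  open ≡-Reasoning

  toℕ : Bool → ℕ
  toℕ true  = 1
  toℕ false = 0

  countIn : (List Step → Bool) → List (List Step) → ℕ
  countIn P ws = length (filterᵇ P ws)

  count : (List Step → Bool) → ℕ → ℕ
  count P m = countIn P (words m)

  countIn-∷ : ∀ P w ws → countIn P (w ∷ ws) ≡ toℕ (P w) + countIn P ws
  countIn-∷ P w ws with P w
  ... | true  = refl
  ... | false = refl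

  countIn-extend : ∀ P ws → countIn P (concatMap (λ w → (u ∷ w) ∷ (d ∷ w) ∷ []) ws)
                          ≡ countIn (λ w → P (u ∷ w)) ws + countIn (λ w → P (d ∷ w)) ws
  countIn-extend P []       = refl
  countIn-extend P (w ∷ ws) = begin
      countIn P ((u ∷ w) ∷ (d ∷ w) ∷ concatMap _ ws)
    ≡⟨ trans (countIn-∷ P (u ∷ w) _) (cong (λ c → toℕ (P (u ∷ w)) + c) (countIn-∷ P (d ∷ w) _)) ⟩
      toℕ (P (u ∷ w)) + (toℕ (P (d ∷ w)) + countIn P (concatMap _ ws))
    ≡⟨ cong (λ c → toℕ (P (u ∷ w)) + (toℕ (P (d ∷ w)) + c)) (countIn-extend P ws) ⟩
      toℕ (P (u ∷ w)) + (toℕ (P (d ∷ w)) + (countIn Pᵤ ws + countIn Pd ws))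
    ≡⟨ interchange (toℕ (P (u ∷ w))) (toℕ (P (d ∷ w))) (countIn Pᵤ ws) (countIn Pd ws) ⟩
      (toℕ (P (u ∷ w)) + countIn Pᵤ ws) + (toℕ (P (d ∷ w)) + countIn Pd ws)
    ≡⟨ sym (cong₂ _+_ (countIn-∷ Pᵤ w ws) (countIn-∷ Pd w ws)) ⟩
      countIn Pᵤ (w ∷ ws) + countIn Pd (w ∷ ws)
    ∎
    where
    Pᵤ Pd : List Step → Bool
    Pᵤ w = P (u ∷ w)
    Pd w = P (d ∷ w)
    interchange : ∀ a b c e → a + (b + (c + e)) ≡ (a + c) + (b + e)
    interchange = solve-∀

  count-zero : ∀ P → count P 0 ≡ toℕ (P [])
  count-zero P = trans (countIn-∷ P [] []) (Data.Nat.Properties.+-identityʳ _)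
    where import Data.Nat.Properties

  count-suc : ∀ P m → + count P (suc m) ≡ + count (λ w → P (u ∷ w)) m ℤ.+ + count (λ w → P (d ∷ w)) m
  count-suc P m = trans (cong +_ (countIn-extend P (words m))) (ℤ.pos-+ (count (λ w → P (u ∷ w)) m) _)

  count-split : ∀ m B (P : List Step → Bool) (Q : ℕ → List Step → Bool) →
                (∀ w → length w ≡ m → + toℕ (P w) ≡ sumTo B (λ a → + toℕ (Q a w))) →
                + count P m ≡ sumTo B (λ a → + count (Q a) m)
  count-split zero    B P Q P≡ΣQ =
    trans (cong +_ (count-zero P)) (trans (P≡ΣQ [] refl) (sumTo-cong B (λ a _ → cong +_ (sym (count-zero (Q a))))))
  count-split (suc m) B P Q P≡ΣQ = begin
      + count P (suc m)
    ≡⟨ count-suc P m ⟩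
      + count (λ w → P (u ∷ w)) m ℤ.+ + count (λ w → P (d ∷ w)) m
    ≡⟨ cong₂ ℤ._+_ (count-split m B _ (λ a w → Q a (u ∷ w)) (λ w |w| → P≡ΣQ (u ∷ w) (cong suc |w|)))
                   (count-split m B _ (λ a w → Q a (d ∷ w)) (λ w |w| → P≡ΣQ (d ∷ w) (cong suc |w|))) ⟩
      sumTo B (λ a → + count (λ w → Q a (u ∷ w)) m) ℤ.+ sumTo B (λ a → + count (λ w → Q a (d ∷ w)) m)
    ≡⟨ sym (sumTo-+ B _ _) ⟩
      sumTo B (λ a → + count (λ w → Q a (u ∷ w)) m ℤ.+ + count (λ w → Q a (d ∷ w)) m)
    ≡⟨ sumTo-cong B (λ a _ → sym (count-suc (Q a) m)) ⟩
      sumTo B (λ a → + count (Q a) (suc m))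
    ∎

  count-cong : ∀ m (P Q : List Step → Bool) → (∀ w → length w ≡ m → P w ≡ Q w) → count P m ≡ count Q m
  count-cong m P Q P≗Q = ℤ.+-injective (count-split m 0 P (λ _ → Q) (λ w |w| → cong (λ b → + toℕ b) (P≗Q w |w|)))

  count-false : ∀ m → count (λ _ → false) m ≡ 0
  count-false zero    = refl
  count-false (suc m) = ℤ.+-injective (trans (count-suc (λ _ → false) m)
                                             (cong₂ (λ a b → + a ℤ.+ + b) (count-false m) (count-false m)))

  sumTo-toℕ-∧ : ∀ B V E (c : ℕ → Bool) U → sumTo B (λ a → + toℕ (c a)) ≡ + toℕ U →
                sumTo B (λ a → + toℕ (V ∧ (c a ∧ E))) ≡ + toℕ (V ∧ (U ∧ E))
  sumTo-toℕ-∧ B false E     c U _     = sumTo-zero B (λ _ _ → refl)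
  sumTo-toℕ-∧ B true  true  c U Σc≡U =
    trans (sumTo-cong B (λ a _ → cong (λ b → + toℕ b) (Bool.∧-identityʳ (c a))))
          (trans Σc≡U (cong (λ b → + toℕ b) (sym (Bool.∧-identityʳ U))))
  sumTo-toℕ-∧ B true  false c U _     =
    trans (sumTo-zero B (λ a _ → cong (λ b → + toℕ b) (Bool.∧-zeroʳ (c a)))) (cong (λ b → + toℕ b) (sym (Bool.∧-zeroʳ U)))

module PeakSequences where

  open FiniteSums
  open BooleanTests
  open WordCounting using (toℕ)
  open import Data.Bool using (Bool; true; false; if_then_else_; _∧_; _∨_)
  open import Data.Bool.Properties as Bool using (∧-conicalˡ; ∧-conicalʳ)
  open import Data.Nat using (ℕ; zero; suc; _+_; _∸_; _≤_; _<_; z≤n; s≤s; _≡ᵇ_; _≤ᵇ_; _<ᵇ_; _⊔_; pred)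
  import Data.Nat.Properties as ℕ
  open import Data.Integer using (+_)
  open import Data.List using (List; []; _∷_; length; take; drop; applyUpTo; foldr)
  open import Data.List.Properties using (map-upTo)
  open import Relation.Binary.PropositionalEquality using (_≡_; refl; cong; cong₂; trans; sym; subst; module ≡-Reasoning)
  open import Relation.Nullary using (¬_; contradiction; yes; no)

  -- xs continues a weakly unimodal sequence whose last term p lies in its weakly increasing part
  unimodalFrom : ℕ → List ℕ → Bool
  unimodalFrom p []       = true
  unimodalFrom p (x ∷ xs) = if p ≤ᵇ x then unimodalFrom x xs else nonincr (x ∷ xs)

  maximum : List ℕ → ℕ
  maximum = foldr _⊔_ 0

  data Phase : Set where
    ascending descending : Phase

  -- The peak heights xs that may follow a peak at height p: in the ascending phase the
  -- sequence must still be weakly unimodal and its maximum must be exactly a.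
  admissible : Phase → ℕ → ℕ → List ℕ → Bool
  admissible ascending  a p []       = a ≡ᵇ 0
  admissible ascending  a p (x ∷ xs) =
    if x <ᵇ a then (p ≤ᵇ x) ∧ admissible ascending a x xs
    else (if x ≡ᵇ a then nonincr (x ∷ xs) else false)
  admissible descending a p xs       = nonincr (p ∷ xs)

  ties : ℕ → List ℕ → ℕ
  ties p []       = 0
  ties p (x ∷ xs) = (if p ≡ᵇ x then 1 else 0) + ties x xs

  nonincr⇒unimodalFrom : ∀ p xs → nonincr (p ∷ xs) ≡ true → unimodalFrom p xs ≡ true
  nonincr⇒unimodalFrom p []       _ = refl
  nonincr⇒unimodalFrom p (x ∷ xs) x≤p∧nonincr with p ≤ᵇ x
  ... | true  = nonincr⇒unimodalFrom x xs (subst (λ b → b ∧ nonincr (x ∷ xs) ≡ true)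
                                                  (∧-conicalˡ (x ≤ᵇ p) _ x≤p∧nonincr) x≤p∧nonincr)
  ... | false = ∧-conicalʳ (x ≤ᵇ p) _ x≤p∧nonincr

  anyUpTo : (ℕ → Bool) → ℕ → Bool
  anyUpTo f n = anyᵇ (applyUpTo f n)

  anyUpTo-cong : ∀ n {f g : ℕ → Bool} → (∀ j → f j ≡ g j) → anyUpTo f n ≡ anyUpTo g n
  anyUpTo-cong zero    f≗g = refl
  anyUpTo-cong (suc n) f≗g = cong₂ _∨_ (f≗g 0) (anyUpTo-cong n (λ j → f≗g (suc j)))

  anyUpTo-∧ : ∀ n b (f : ℕ → Bool) → anyUpTo (λ j → b ∧ f j) n ≡ b ∧ anyUpTo f n
  anyUpTo-∧ n true  f = refl
  anyUpTo-∧ n false f = false-everywhere n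
    where false-everywhere : ∀ n → anyUpTo (λ _ → false) n ≡ false
          false-everywhere zero    = refl
          false-everywhere (suc n) = false-everywhere n

  turnsAfterHead : ℕ → List ℕ → Bool
  turnsAfterHead x xs = anyUpTo (λ j → nondecr (x ∷ take j xs) ∧ nonincr (drop j (x ∷ xs))) (suc (length xs))

  turnsAfterHead≡unimodalFrom : ∀ x xs → turnsAfterHead x xs ≡ unimodalFrom x xs
  turnsAfterHead≡unimodalFrom x []       = refl
  turnsAfterHead≡unimodalFrom x (y ∷ ys) = begin
      nonincr (x ∷ y ∷ ys) ∨ anyUpTo (λ j → ((x ≤ᵇ y) ∧ nondecr (y ∷ take j ys)) ∧ nonincr (drop j (y ∷ ys))) (suc (length ys))
    ≡⟨ cong (nonincr (x ∷ y ∷ ys) ∨_) (trans (anyUpTo-cong (suc (length ys)) reassociate) (anyUpTo-∧ (suc (length ys)) (x ≤ᵇ y) split-y)) ⟩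
      ((y ≤ᵇ x) ∧ nonincr (y ∷ ys)) ∨ ((x ≤ᵇ y) ∧ turnsAfterHead y ys)
    ≡⟨ cong (λ b → ((y ≤ᵇ x) ∧ nonincr (y ∷ ys)) ∨ ((x ≤ᵇ y) ∧ b)) (turnsAfterHead≡unimodalFrom y ys) ⟩
      ((y ≤ᵇ x) ∧ nonincr (y ∷ ys)) ∨ ((x ≤ᵇ y) ∧ unimodalFrom y ys)
    ≡⟨ by-cases ⟩
      (if x ≤ᵇ y then unimodalFrom y ys else nonincr (y ∷ ys))
    ∎
    where
    open ≡-Reasoning
    split-y : ℕ → Bool
    split-y j = nondecr (y ∷ take j ys) ∧ nonincr (drop j (y ∷ ys))
    reassociate : ∀ j → ((x ≤ᵇ y) ∧ nondecr (y ∷ take j ys)) ∧ nonincr (drop j (y ∷ ys)) ≡ (x ≤ᵇ y) ∧ split-y j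
    reassociate j = Bool.∧-assoc (x ≤ᵇ y) (nondecr (y ∷ take j ys)) (nonincr (drop j (y ∷ ys)))
    by-cases : ((y ≤ᵇ x) ∧ nonincr (y ∷ ys)) ∨ ((x ≤ᵇ y) ∧ unimodalFrom y ys)
             ≡ (if x ≤ᵇ y then unimodalFrom y ys else nonincr (y ∷ ys))
    by-cases with x ≤ᵇ y in x≤ᵇy
    ... | false rewrite ≤⇒≤ᵇ≡true (ℕ.<⇒≤ (≤ᵇ≡false⇒> x y x≤ᵇy)) = Bool.∨-identityʳ _
    ... | true with nonincr (y ∷ ys) in y∷ys-nonincr
    ...   | false = cong (_∨ unimodalFrom y ys) (Bool.∧-zeroʳ (y ≤ᵇ x))
    ...   | true rewrite nonincr⇒unimodalFrom y ys y∷ys-nonincr = Bool.∨-zeroʳ _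

  weaklyUnimodal≡unimodalFrom0 : ∀ xs → weaklyUnimodal xs ≡ unimodalFrom 0 xs
  weaklyUnimodal≡unimodalFrom0 []       = refl
  weaklyUnimodal≡unimodalFrom0 (x ∷ xs) = begin
      weaklyUnimodal (x ∷ xs)
    ≡⟨ cong anyᵇ (map-upTo (λ j → nondecr (take j (x ∷ xs)) ∧ nonincr (drop (j ∸ 1) (x ∷ xs))) (suc (length (x ∷ xs)))) ⟩
      nonincr (x ∷ xs) ∨ (nonincr (x ∷ xs) ∨ later)
    ≡⟨ sym (Bool.∨-assoc (nonincr (x ∷ xs)) _ later) ⟩
      (nonincr (x ∷ xs) ∨ nonincr (x ∷ xs)) ∨ later
    ≡⟨ cong (_∨ later) (Bool.∨-idem (nonincr (x ∷ xs))) ⟩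
      turnsAfterHead x xs
    ≡⟨ turnsAfterHead≡unimodalFrom x xs ⟩
      unimodalFrom x xs
    ∎
    where
    open ≡-Reasoning
    later : Bool
    later = anyUpTo (λ j → nondecr (x ∷ take (suc j) xs) ∧ nonincr (drop (suc j) (x ∷ xs))) (length xs)

  nonincr⇒maximum≤ : ∀ p xs → nonincr (p ∷ xs) ≡ true → maximum xs ≤ p
  nonincr⇒maximum≤ p []       _ = z≤n
  nonincr⇒maximum≤ p (x ∷ xs) x≤p∧nonincr =
    ℕ.⊔-lub x≤p (ℕ.≤-trans (nonincr⇒maximum≤ x xs (∧-conicalʳ (x ≤ᵇ p) _ x≤p∧nonincr)) x≤p)
    where x≤p = ≤ᵇ≡true⇒≤ x p (∧-conicalˡ (x ≤ᵇ p) _ x≤p∧nonincr)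

  unimodalFrom-maximum≤ : ∀ p xs → maximum xs ≤ p → unimodalFrom p xs ≡ nonincr (p ∷ xs)
  unimodalFrom-maximum≤ p []       _ = refl
  unimodalFrom-maximum≤ p (x ∷ xs) x⊔max≤p =
    below (ℕ.m⊔n≤o⇒m≤o x (maximum xs) x⊔max≤p) (ℕ.m⊔n≤o⇒n≤o x (maximum xs) x⊔max≤p)
    where
    below : x ≤ p → maximum xs ≤ p → unimodalFrom p (x ∷ xs) ≡ nonincr (p ∷ x ∷ xs)
    below x≤p max≤p rewrite ≤⇒≤ᵇ≡true x≤p with p ≤ᵇ x in p≤ᵇx
    ... | true rewrite ℕ.≤-antisym x≤p (≤ᵇ≡true⇒≤ p x p≤ᵇx) = unimodalFrom-maximum≤ p xs max≤p
    ... | false = refl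

  admissible-maximum : ∀ p xs → admissible ascending (maximum xs) p xs ≡ unimodalFrom p xs
  admissible-maximum p []       = refl
  admissible-maximum p (x ∷ xs) with x ℕ.<? maximum xs
  ... | yes x<max rewrite ℕ.m≤n⇒m⊔n≡n (ℕ.<⇒≤ x<max) | <⇒<ᵇ≡true x<max with p ≤ᵇ x
  ...   | true  = admissible-maximum x xs
  ...   | false with nonincr (x ∷ xs) in x∷xs-nonincr
  ...     | false = refl
  ...     | true  = contradiction (nonincr⇒maximum≤ x xs x∷xs-nonincr) (ℕ.<⇒≱ x<max)
  admissible-maximum p (x ∷ xs) | no x≮max
    rewrite ℕ.m≥n⇒m⊔n≡m (ℕ.≮⇒≥ x≮max) | ≮⇒<ᵇ≡false (ℕ.<-irrefl {x} refl) | ≡⇒≡ᵇ≡true {x} refl with p ≤ᵇ x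
  ... | true  = sym (unimodalFrom-maximum≤ x xs (ℕ.≮⇒≥ x≮max))
  ... | false = refl

  admissible⇒maximum : ∀ a p xs → admissible ascending a p xs ≡ true → a ≡ maximum xs
  admissible⇒maximum a p []       a≡ᵇ0 = ≡ᵇ≡true⇒≡ a 0 a≡ᵇ0
  admissible⇒maximum a p (x ∷ xs) adm with x <ᵇ a in x<ᵇa
  ... | true = trans a≡max (sym (ℕ.m≤n⇒m⊔n≡n (ℕ.<⇒≤ (subst (x <_) a≡max (<ᵇ≡true⇒< x a x<ᵇa)))))
    where a≡max = admissible⇒maximum a x xs (∧-conicalʳ (p ≤ᵇ x) _ adm)
  ... | false with x ≡ᵇ a in x≡ᵇa
  ...   | true  = trans (sym (≡ᵇ≡true⇒≡ x a x≡ᵇa)) (sym (ℕ.m≥n⇒m⊔n≡m (nonincr⇒maximum≤ x xs adm)))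
  ...   | false = contradiction adm λ ()

  sumTo-admissible : ∀ B xs → maximum xs ≤ B →
                     sumTo B (λ a → + toℕ (admissible ascending a 0 xs)) ≡ + toℕ (unimodalFrom 0 xs)
  sumTo-admissible B xs max≤B =
    trans (sumTo-single B (maximum xs) max≤B (λ a _ a≢max → cong (λ b → + toℕ b) (not-admissible a a≢max)))
          (cong (λ b → + toℕ b) (admissible-maximum 0 xs))
    where
    not-admissible : ∀ a → ¬ a ≡ maximum xs → admissible ascending a 0 xs ≡ false
    not-admissible a a≢max with admissible ascending a 0 xs in adm
    ... | true  = contradiction (admissible⇒maximum a 0 xs adm) a≢max
    ... | false = refl

  -- No peak has height 0, so the tie with the initial 0 is never counted.
  ties-peaksAt : ∀ h w → ties 0 (peaksAt h w) ≡ eqPairs (peaksAt h w)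
  ties-peaksAt h []          = refl
  ties-peaksAt h (u ∷ [])    = refl
  ties-peaksAt h (u ∷ d ∷ w) = tied (suc h) (peaksAt h w)
    where
    tied : ∀ x xs → ties x xs ≡ eqPairs (x ∷ xs)
    tied x []       = refl
    tied x (y ∷ ys) = cong (λ t → (if x ≡ᵇ y then 1 else 0) + t) (tied y ys)
  ties-peaksAt h (u ∷ u ∷ w) = ties-peaksAt (suc h) (u ∷ w)
  ties-peaksAt h (d ∷ w)     = ties-peaksAt (pred h) w

  maximum-peaksAt : ∀ h w → maximum (peaksAt h w) ≤ h + length w
  maximum-peaksAt h []          = z≤n
  maximum-peaksAt h (u ∷ [])    = z≤n
  maximum-peaksAt h (u ∷ d ∷ w) =
    ℕ.⊔-lub (subst (suc h ≤_) (sym (ℕ.+-suc h (suc (length w)))) (s≤s (ℕ.m≤m+n h _)))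
            (ℕ.≤-trans (maximum-peaksAt h w) (ℕ.+-monoʳ-≤ h (ℕ.≤-trans (ℕ.n≤1+n _) (ℕ.n≤1+n _))))
  maximum-peaksAt h (u ∷ u ∷ w) =
    subst (maximum (peaksAt (suc h) (u ∷ w)) ≤_) (sym (ℕ.+-suc h (suc (length w)))) (maximum-peaksAt (suc h) (u ∷ w))
  maximum-peaksAt h (d ∷ w)     =
    ℕ.≤-trans (maximum-peaksAt (pred h) w)
              (ℕ.≤-trans (ℕ.+-monoˡ-≤ (length w) (ℕ.pred[n]≤n {h})) (ℕ.+-monoʳ-≤ h (ℕ.n≤1+n (length w))))

  validAt⇒height≤length : ∀ h w → validAt h w ≡ true → h ≤ length w
  validAt⇒height≤length h       []      h≡ᵇ0  = ℕ.≤-reflexive (≡ᵇ≡true⇒≡ h 0 h≡ᵇ0)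
  validAt⇒height≤length h       (u ∷ w) valid =
    ℕ.m≤n⇒m≤1+n (ℕ.≤-trans (ℕ.n≤1+n h) (validAt⇒height≤length (suc h) w valid))
  validAt⇒height≤length (suc h) (d ∷ w) valid = s≤s (validAt⇒height≤length h w valid)

module StateSeries where

  open SeriesRing
  open Coefficients
  open RightHandSide
  open BooleanTests
  open import Algebra.Bundles using (CommutativeRing)
  open import Relation.Binary.Reasoning.Setoid (CommutativeRing.setoid series-commutativeRing)
  open import Data.Bool using (Bool; true; false; if_then_else_)
  open import Data.Nat using (ℕ; zero; suc; _+_; _∸_; _≤_; _<_; z≤n; s≤s; _≡ᵇ_; _≤ᵇ_; _<ᵇ_)
  import Data.Nat.Properties as ℕ
  open import Relation.Binary.Definitions using (tri<; tri≈; tri>)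
  open import Relation.Binary.PropositionalEquality using (_≡_; refl; cong; sym; subst)

  zS⊗0ˢ⊕ : ∀ F → zS ⊗ 0ˢ ⊕ F ≈ F
  zS⊗0ˢ⊕ F = ≈-trans (⊕-congʳ F (⊗-zeroʳ zS)) (⊕-identityˡ F)

  -- a peak tied with the previous one contributes a factor s
  tieIf : Bool → Ser → Ser
  tieIf b F = if b then sS ⊗ F else F

  tieIf-cong : ∀ b {F G} → F ≈ G → tieIf b F ≈ tieIf b G
  tieIf-cong true  F≈G = ⊗-congˡ sS F≈G
  tieIf-cong false F≈G = F≈G

  1+h<p⇒p∸[1+h]≡suc : ∀ h p → suc h < p → p ∸ suc h ≡ suc (p ∸ suc (suc h))
  1+h<p⇒p∸[1+h]≡suc h p 1+h<p = ℕ.+-∸-assoc 1 1+h<p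

  -- Closed forms of the generating functions of the completions in the descending phase:
  -- desc h p from height h after a last peak at height p > h, descUp h p for those starting
  -- with an up step, and descClimb e x = descUp (x - 1) (x + e).
  descClimb : ℕ → ℕ → Ser
  descClimb zero    x = sS ⊗ ρ x
  descClimb (suc e) x = zS ⊗ descClimb e (suc x) ⊕ ρ x

  descUp : ℕ → ℕ → Ser
  descUp h p = if suc h ≤ᵇ p then descClimb (p ∸ suc h) (suc h) else 0ˢ

  desc : ℕ → ℕ → Ser
  desc zero    p = 𝟙 ⊕ zS ⊗ descUp zero p
  desc (suc h) p = desc h p ⊕ zS ⊗ descUp (suc h) p

  descPeakClosed : ℕ → ℕ → Ser
  descPeakClosed h p = if suc h ≤ᵇ p then tieIf (p ≡ᵇ suc h) (ρ (suc h)) else 0ˢ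

  descUp-step : ∀ h p → descUp h p ≈ zS ⊗ descUp (suc h) p ⊕ descPeakClosed h p
  descUp-step h p with ℕ.<-cmp (suc h) p
  ... | tri< 1+h<p _ _
    rewrite ≤⇒≤ᵇ≡true (ℕ.<⇒≤ 1+h<p) | ≤⇒≤ᵇ≡true 1+h<p | ≢⇒≡ᵇ≡false (ℕ.>⇒≢ 1+h<p)
          | 1+h<p⇒p∸[1+h]≡suc h p 1+h<p = ≈-refl
  ... | tri≈ _ refl _
    rewrite ≤⇒≤ᵇ≡true (ℕ.≤-refl {suc h}) | ≰⇒≤ᵇ≡false (ℕ.<-irrefl {suc h} refl)
          | ≡⇒≡ᵇ≡true {suc h} refl | ℕ.n∸n≡0 h = ≈-sym (zS⊗0ˢ⊕ (sS ⊗ ρ (suc h)))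
  ... | tri> _ _ p<1+h
    rewrite ≰⇒≤ᵇ≡false (ℕ.<⇒≱ p<1+h) | ≰⇒≤ᵇ≡false (ℕ.<⇒≱ (ℕ.m<n⇒m<1+n p<1+h)) =
    ≈-sym (zS⊗0ˢ⊕ 0ˢ)

  descUp-top : ∀ h → descUp h (suc h) ≈ sS ⊗ ρ (suc h)
  descUp-top h rewrite ≤⇒≤ᵇ≡true (ℕ.≤-refl {suc h}) | ℕ.n∸n≡0 h = ≈-refl

  descUp-below : ∀ h p → suc h < p → descUp h p ≈ zS ⊗ descUp (suc h) p ⊕ ρ (suc h)
  descUp-below h p 1+h<p = ≈-trans (descUp-step h p) (≈-reflexive (cong (zS ⊗ descUp (suc h) p ⊕_) peak))
    where peak : descPeakClosed h p ≡ ρ (suc h)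
          peak rewrite ≤⇒≤ᵇ≡true (ℕ.<⇒≤ 1+h<p) | ≢⇒≡ᵇ≡false (ℕ.>⇒≢ 1+h<p) = refl

  desc≈ : ∀ h p → suc h ≤ p → desc h p ≈ 𝟙 ⊕ Σ-Xρ h ⊕ X (suc h) ⊗ descUp h p
  desc≈ zero    p _     = ⊕-cong (≈-sym (⊕-identityʳ 𝟙)) (⊗-congʳ (descUp zero p) (≈-sym X-1))
  desc≈ (suc h) p 1+h<p = begin
      desc h p ⊕ zS ⊗ descUp (suc h) p
    ≈⟨ ⊕-congʳ (zS ⊗ descUp (suc h) p) (desc≈ h p (ℕ.<⇒≤ 1+h<p)) ⟩
      𝟙 ⊕ Σ-Xρ h ⊕ X (suc h) ⊗ descUp h p ⊕ zS ⊗ descUp (suc h) p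
    ≈⟨ ⊕-congʳ (zS ⊗ descUp (suc h) p) (⊕-congˡ (𝟙 ⊕ Σ-Xρ h) (⊗-congˡ (X (suc h)) (descUp-below h p 1+h<p))) ⟩
      𝟙 ⊕ Σ-Xρ h ⊕ X (suc h) ⊗ (zS ⊗ descUp (suc h) p ⊕ ρ (suc h)) ⊕ zS ⊗ descUp (suc h) p
    ≈⟨ regroup 𝟙 (Σ-Xρ h) (X (suc h)) zS (descUp (suc h) p) (ρ (suc h)) ⟩
      𝟙 ⊕ Σ-Xρ (suc h) ⊕ (zS ⊕ zS ⊗ X (suc h)) ⊗ descUp (suc h) p
    ≈⟨ ⊕-congˡ (𝟙 ⊕ Σ-Xρ (suc h)) (⊗-congʳ (descUp (suc h) p) (≈-sym (X-suc (suc h)))) ⟩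
      𝟙 ⊕ Σ-Xρ (suc h) ⊕ X (suc (suc h)) ⊗ descUp (suc h) p
    ∎
    where regroup : ∀ o s x z u r → o ⊕ s ⊕ x ⊗ (z ⊗ u ⊕ r) ⊕ z ⊗ u ≈ o ⊕ (s ⊕ x ⊗ r) ⊕ (z ⊕ z ⊗ x) ⊗ u
          regroup = solve 6 (λ o s x z u r → o :+ s :+ x :* (z :* u :+ r) :+ z :* u := o :+ (s :+ x :* r) :+ (z :+ z :* x) :* u) ≈-refl

  desc-peak : ∀ h → desc h (suc h) ≈ ρ (suc h)
  desc-peak h = begin
      desc h (suc h)
    ≈⟨ desc≈ h (suc h) ℕ.≤-refl ⟩
      𝟙 ⊕ Σ-Xρ h ⊕ X (suc h) ⊗ descUp h (suc h)
    ≈⟨ ⊕-cong (≈-sym (Π-suc≈ h)) (⊗-congˡ (X (suc h)) (descUp-top h)) ⟩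
      Π (suc h) ⊕ X (suc h) ⊗ (sS ⊗ ρ (suc h))
    ≈⟨ ⊕-congˡ (Π (suc h)) (swap (X (suc h)) sS (ρ (suc h))) ⟩
      Π (suc h) ⊕ sS ⊗ X (suc h) ⊗ ρ (suc h)
    ≈⟨ ≈-sym (ρ-unfold (suc h)) ⟩
      ρ (suc h)
    ∎
    where swap : ∀ x s r → x ⊗ (s ⊗ r) ≈ s ⊗ x ⊗ r
          swap = solve 3 (λ x s r → x :* (s :* r) := s :* x :* r) ≈-refl

  descPeak : ℕ → ℕ → Ser
  descPeak h p = if suc h ≤ᵇ p then tieIf (p ≡ᵇ suc h) (desc h (suc h)) else 0ˢ

  descUp-recurrence : ∀ h p → descUp h p ≈ zS ⊗ descUp (suc h) p ⊕ descPeak h p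
  descUp-recurrence h p = ≈-trans (descUp-step h p) (⊕-congˡ (zS ⊗ descUp (suc h) p) peak)
    where peak : descPeakClosed h p ≈ descPeak h p
          peak with suc h ≤ᵇ p
          ... | true  = tieIf-cong (p ≡ᵇ suc h) (≈-sym (desc-peak h))
          ... | false = ≈-refl

  module Ascending (a : ℕ) where

    base : Ser
    base = if a ≡ᵇ 0 then 𝟙 else 0ˢ

    -- The same for the ascending phase with maximum a: asc, ascUp, and ascClimbFrom p e x
    -- = ascUp (x - 1) p where x + e = a. When p < x this is ascClimb e x; afterPeak e x is
    -- the series just after a peak at height x < a.
    mutual
      ascClimb : ℕ → ℕ → Ser
      ascClimb zero    x = ρ x
      ascClimb (suc e) x = afterPeak e x ⊕ zS ⊗ ascClimb e (suc x)

      afterPeak : ℕ → ℕ → Ser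
      afterPeak e x = X x ⊗ γ x ⊗ (zS ⊗ ascClimb e (suc x))

    ascClimbFrom : ℕ → ℕ → ℕ → Ser
    ascClimbFrom p zero    x = tieIf (p ≡ᵇ x) (ρ x)
    ascClimbFrom p (suc e) x = zS ⊗ ascClimbFrom p e (suc x) ⊕ (if p ≤ᵇ x then tieIf (p ≡ᵇ x) (afterPeak e x) else 0ˢ)

    ascUp : ℕ → ℕ → Ser
    ascUp h p = if suc h ≤ᵇ a then ascClimbFrom p (a ∸ suc h) (suc h) else 0ˢ

    asc : ℕ → ℕ → Ser
    asc zero    p = base ⊕ zS ⊗ ascUp zero p
    asc (suc h) p = asc h p ⊕ zS ⊗ ascUp (suc h) p

    ascPeakClosed : ℕ → ℕ → Ser
    ascPeakClosed h p =
      if suc h <ᵇ a then (if p ≤ᵇ suc h then tieIf (p ≡ᵇ suc h) (afterPeak (a ∸ suc (suc h)) (suc h)) else 0ˢ)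
      else (if suc h ≡ᵇ a then tieIf (p ≡ᵇ suc h) (ρ (suc h)) else 0ˢ)

    ascUp-step : ∀ h p → ascUp h p ≈ zS ⊗ ascUp (suc h) p ⊕ ascPeakClosed h p
    ascUp-step h p with ℕ.<-cmp (suc h) a
    ... | tri< 1+h<a _ _
      rewrite ≤⇒≤ᵇ≡true (ℕ.<⇒≤ 1+h<a) | ≤⇒≤ᵇ≡true 1+h<a | 1+h<p⇒p∸[1+h]≡suc h a 1+h<a = ≈-refl
    ... | tri≈ _ refl _
      rewrite ≤⇒≤ᵇ≡true (ℕ.≤-refl {suc h}) | ≰⇒≤ᵇ≡false (ℕ.<-irrefl {suc h} refl)
            | ≡⇒≡ᵇ≡true {suc h} refl | ℕ.n∸n≡0 h = ≈-sym (zS⊗0ˢ⊕ (tieIf (p ≡ᵇ suc h) (ρ (suc h))))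
    ... | tri> _ 1+h≢a a<1+h
      rewrite ≰⇒≤ᵇ≡false (ℕ.<⇒≱ a<1+h) | ≰⇒≤ᵇ≡false (ℕ.<⇒≱ (ℕ.m<n⇒m<1+n a<1+h))
            | ≢⇒≡ᵇ≡false 1+h≢a = ≈-sym (zS⊗0ˢ⊕ 0ˢ)

    asc≈ : ∀ h p → suc h ≤ p → p < a → asc h p ≈ X (suc h) ⊗ ascUp h p
    asc≈ zero p _ p<a rewrite ≢⇒≡ᵇ≡false {a} {0} (λ a≡0 → ℕ.n≮0 (subst (p <_) a≡0 p<a)) =
      ≈-trans (⊕-identityˡ (zS ⊗ ascUp zero p)) (⊗-congʳ (ascUp zero p) (≈-sym X-1))
    asc≈ (suc h) p 1+h<p p<a = begin
        asc h p ⊕ zS ⊗ ascUp (suc h) p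
      ≈⟨ ⊕-congʳ (zS ⊗ ascUp (suc h) p) (asc≈ h p (ℕ.<⇒≤ 1+h<p) p<a) ⟩
        X (suc h) ⊗ ascUp h p ⊕ zS ⊗ ascUp (suc h) p
      ≈⟨ ⊕-congʳ (zS ⊗ ascUp (suc h) p) (⊗-congˡ (X (suc h)) (≈-trans (ascUp-step h p)
           (≈-trans (⊕-congˡ (zS ⊗ ascUp (suc h) p) (≈-reflexive no-peak)) (⊕-identityʳ (zS ⊗ ascUp (suc h) p))))) ⟩
        X (suc h) ⊗ (zS ⊗ ascUp (suc h) p) ⊕ zS ⊗ ascUp (suc h) p
      ≈⟨ regroup (X (suc h)) zS (ascUp (suc h) p) ⟩
        (zS ⊕ zS ⊗ X (suc h)) ⊗ ascUp (suc h) p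
      ≈⟨ ⊗-congʳ (ascUp (suc h) p) (≈-sym (X-suc (suc h))) ⟩
        X (suc (suc h)) ⊗ ascUp (suc h) p
      ∎
      where
      regroup : ∀ x z u → x ⊗ (z ⊗ u) ⊕ z ⊗ u ≈ (z ⊕ z ⊗ x) ⊗ u
      regroup = solve 3 (λ x z u → x :* (z :* u) :+ z :* u := (z :+ z :* x) :* u) ≈-refl
      no-peak : ascPeakClosed h p ≡ 0ˢ
      no-peak rewrite <⇒<ᵇ≡true (ℕ.<-trans 1+h<p p<a) | ≰⇒≤ᵇ≡false (ℕ.<⇒≱ 1+h<p) = refl

    ascClimbFrom-above : ∀ p e x → p < x → ascClimbFrom p e x ≈ ascClimb e x
    ascClimbFrom-above p zero    x p<x rewrite ≢⇒≡ᵇ≡false (ℕ.<⇒≢ p<x) = ≈-refl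
    ascClimbFrom-above p (suc e) x p<x rewrite ≤⇒≤ᵇ≡true (ℕ.<⇒≤ p<x) | ≢⇒≡ᵇ≡false (ℕ.<⇒≢ p<x) =
      ≈-trans (⊕-congʳ (afterPeak e x) (⊗-congˡ zS (ascClimbFrom-above p e (suc x) (ℕ.m<n⇒m<1+n p<x))))
              (⊕-comm (zS ⊗ ascClimb e (suc x)) (afterPeak e x))

    -- The two descriptions of the state just after a peak at height h + 1 < a agree.
    asc-peak : ∀ h → suc h < a → asc h (suc h) ≈ afterPeak (a ∸ suc (suc h)) (suc h)
    asc-peak h 1+h<a = begin
        asc h x
      ≈⟨ asc≈ h x ℕ.≤-refl 1+h<a ⟩
        X x ⊗ ascUp h x
      ≈⟨ ⊗-congˡ (X x) (≈-trans (ascUp-step h x) (⊕-cong (⊗-congˡ zS up) (≈-reflexive peak))) ⟩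
        X x ⊗ (W ⊕ sS ⊗ (X x ⊗ γ x ⊗ W))
      ≈⟨ factorize (X x) W sS (γ x) ⟩
        X x ⊗ (𝟙 ⊕ sS ⊗ X x ⊗ γ x) ⊗ W
      ≈⟨ ⊗-congʳ W (⊗-congˡ (X x) (≈-sym (γ-unfold x))) ⟩
        X x ⊗ γ x ⊗ W
      ∎
      where
      x = suc h
      e = a ∸ suc (suc h)
      W = zS ⊗ ascClimb e (suc x)
      up : ascUp (suc h) x ≈ ascClimb e (suc x)
      up rewrite ≤⇒≤ᵇ≡true 1+h<a = ascClimbFrom-above x e (suc x) ℕ.≤-refl
      peak : ascPeakClosed h x ≡ sS ⊗ afterPeak e x
      peak rewrite <⇒<ᵇ≡true 1+h<a | ≤⇒≤ᵇ≡true (ℕ.≤-refl {x}) | ≡⇒≡ᵇ≡true {x} refl = refl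
      factorize : ∀ X W s g → X ⊗ (W ⊕ s ⊗ (X ⊗ g ⊗ W)) ≈ X ⊗ (𝟙 ⊕ s ⊗ X ⊗ g) ⊗ W
      factorize = solve 4 (λ X W s g → X :* (W :+ s :* (X :* g :* W)) := X :* (con 1 :+ s :* X :* g) :* W) ≈-refl

    ascPeak : ℕ → ℕ → Ser
    ascPeak h p =
      if suc h <ᵇ a then (if p ≤ᵇ suc h then tieIf (p ≡ᵇ suc h) (asc h (suc h)) else 0ˢ)
      else (if suc h ≡ᵇ a then tieIf (p ≡ᵇ suc h) (desc h (suc h)) else 0ˢ)

    ascUp-recurrence : ∀ h p → ascUp h p ≈ zS ⊗ ascUp (suc h) p ⊕ ascPeak h p
    ascUp-recurrence h p = ≈-trans (ascUp-step h p) (⊕-congˡ (zS ⊗ ascUp (suc h) p) peak)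
      where
      peak : ascPeakClosed h p ≈ ascPeak h p
      peak with suc h <ᵇ a in 1+h<ᵇa
      peak | true with p ≤ᵇ suc h
      ... | true  = tieIf-cong (p ≡ᵇ suc h) (≈-sym (asc-peak h (<ᵇ≡true⇒< (suc h) a 1+h<ᵇa)))
      ... | false = ≈-refl
      peak | false with suc h ≡ᵇ a
      ... | true  = tieIf-cong (p ≡ᵇ suc h) (≈-sym (desc-peak h))
      ... | false = ≈-refl

  factorsFrom : ℕ → ℕ → Ser
  factorsFrom x zero    = 𝟙
  factorsFrom x (suc e) = factor x ⊗ factorsFrom (suc x) e

  factorsFrom-suc : ∀ x e → factorsFrom x (suc e) ≈ factorsFrom x e ⊗ factor (x + e)
  factorsFrom-suc x zero rewrite ℕ.+-identityʳ x = ⊗-comm (factor x) 𝟙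
  factorsFrom-suc x (suc e) = begin
      factor x ⊗ factorsFrom (suc x) (suc e)
    ≈⟨ ⊗-congˡ (factor x) (factorsFrom-suc (suc x) e) ⟩
      factor x ⊗ (factorsFrom (suc x) e ⊗ factor (suc x + e))
    ≈⟨ ≈-sym (⊗-assoc (factor x) (factorsFrom (suc x) e) (factor (suc x + e))) ⟩
      factor x ⊗ factorsFrom (suc x) e ⊗ factor (suc x + e)
    ≈⟨ ≈-reflexive (cong (λ y → factor x ⊗ factorsFrom (suc x) e ⊗ factor y) (sym (ℕ.+-suc x e))) ⟩
      factor x ⊗ factorsFrom (suc x) e ⊗ factor (x + suc e)
    ∎

  factorsFrom-1 : ∀ e → factorsFrom 1 e ≈ Π (suc e)
  factorsFrom-1 zero    = ≈-refl
  factorsFrom-1 (suc e) = ≈-trans (factorsFrom-suc 1 e) (⊗-congʳ (factor (suc e)) (factorsFrom-1 e))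

  -- Each height x passed on the way up contributes factor x = 1 + X x γ x:
  -- either no peak there, or a peak followed by a descent and a return to height x + 1.
  ascClimb≈ : ∀ a e x → Ascending.ascClimb a e x ≈ (zS ^ˢ e) ⊗ factorsFrom x e ⊗ ρ (x + e)
  ascClimb≈ a zero    x rewrite ℕ.+-identityʳ x = ≈-sym (≈-trans (⊗-congʳ (ρ x) (⊗-identityˡ 𝟙)) (⊗-identityˡ (ρ x)))
  ascClimb≈ a (suc e) x = begin
      X x ⊗ γ x ⊗ W ⊕ W
    ≈⟨ factorize (X x) (γ x) W ⟩
      (𝟙 ⊕ X x ⊗ γ x) ⊗ W
    ≈⟨ ⊗-congʳ W (≈-sym (factor≈ x)) ⟩
      factor x ⊗ W
    ≈⟨ ⊗-congˡ (factor x) (⊗-congˡ zS (ascClimb≈ a e (suc x))) ⟩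
      factor x ⊗ (zS ⊗ ((zS ^ˢ e) ⊗ factorsFrom (suc x) e ⊗ ρ (suc x + e)))
    ≈⟨ reorder (factor x) zS (zS ^ˢ e) (factorsFrom (suc x) e) (ρ (suc x + e)) ⟩
      zS ⊗ (zS ^ˢ e) ⊗ (factor x ⊗ factorsFrom (suc x) e) ⊗ ρ (suc x + e)
    ≈⟨ ≈-reflexive (cong (λ y → zS ⊗ (zS ^ˢ e) ⊗ (factor x ⊗ factorsFrom (suc x) e) ⊗ ρ y) (sym (ℕ.+-suc x e))) ⟩
      zS ⊗ (zS ^ˢ e) ⊗ (factor x ⊗ factorsFrom (suc x) e) ⊗ ρ (x + suc e)
    ∎
    where
    W = zS ⊗ Ascending.ascClimb a e (suc x)
    factorize : ∀ X g W → X ⊗ g ⊗ W ⊕ W ≈ (𝟙 ⊕ X ⊗ g) ⊗ W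
    factorize = solve 3 (λ X g W → X :* g :* W :+ W := (con 1 :+ X :* g) :* W) ≈-refl
    reorder : ∀ f z Z P r → f ⊗ (z ⊗ (Z ⊗ P ⊗ r)) ≈ z ⊗ Z ⊗ (f ⊗ P) ⊗ r
    reorder = solve 5 (λ f z Z P r → f :* (z :* (Z :* P :* r)) := z :* Z :* (f :* P) :* r) ≈-refl

  asc-start-0 : Ascending.asc 0 0 0 ≈ 𝟙
  asc-start-0 = ≈-trans (⊕-congˡ 𝟙 (⊗-zeroʳ zS)) (⊕-identityʳ 𝟙)

  asc-start-suc : ∀ e → Ascending.asc (suc e) 0 0 ≈ term (suc e)
  asc-start-suc e = begin
      0ˢ ⊕ zS ⊗ ascClimbFrom 0 e 1
    ≈⟨ ⊕-identityˡ _ ⟩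
      zS ⊗ ascClimbFrom 0 e 1
    ≈⟨ ⊗-congˡ zS (≈-trans (ascClimbFrom-above 0 e 1 (s≤s z≤n)) (ascClimb≈ (suc e) e 1)) ⟩
      zS ⊗ ((zS ^ˢ e) ⊗ factorsFrom 1 e ⊗ ρ (suc e))
    ≈⟨ ⊗-congˡ zS (⊗-congʳ (ρ (suc e)) (⊗-congˡ (zS ^ˢ e) (factorsFrom-1 e))) ⟩
      zS ⊗ ((zS ^ˢ e) ⊗ Π (suc e) ⊗ (Π (suc e) ⊗ γ (suc e)))
    ≈⟨ reorder zS (zS ^ˢ e) (Π (suc e)) (γ (suc e)) ⟩
      zS ⊗ (zS ^ˢ e) ⊗ γ (suc e) ⊗ (Π (suc e) ⊗ (Π (suc e) ⊗ 𝟙))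
    ≈⟨ ⊗-congʳ (Π (suc e) ⊗ (Π (suc e) ⊗ 𝟙)) (⊗-congʳ (γ (suc e)) (≈-sym (mono≈zS^ (suc e)))) ⟩
      term (suc e)
    ∎
    where
    open Ascending (suc e) using (ascClimbFrom; ascClimbFrom-above)
    reorder : ∀ z Z P g → z ⊗ (Z ⊗ P ⊗ (P ⊗ g)) ≈ z ⊗ Z ⊗ g ⊗ (P ⊗ (P ⊗ 𝟙))
    reorder = solve 4 (λ z Z P g → z :* (Z :* P :* (P :* g)) := z :* Z :* g :* (P :* (P :* con 1))) ≈-refl

  asc-start : ∀ n k a → Ascending.asc a 0 0 n k ≡ (if a ≡ᵇ 0 then 𝟙 n k else term a n k)
  asc-start n k zero    = coeff asc-start-0 n k
  asc-start n k (suc a) = coeff (asc-start-suc a) n k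

module Transfer where

  open SeriesRing
  open Coefficients
  open WordCounting
  open PeakSequences
  open StateSeries
  open import Data.Bool using (Bool; true; false; if_then_else_; _∧_)
  import Data.Bool.Properties as Bool
  open import Data.Nat using (ℕ; zero; suc; _+_; _≤_; _<_; _≡ᵇ_; _≤ᵇ_; _<ᵇ_)
  import Data.Nat.Properties as ℕ
  open import Data.Integer as ℤ using (+_)
  import Data.Integer.Properties as ℤ
  open import Data.List using (List; []; _∷_; length)
  open import Relation.Binary.PropositionalEquality using (_≡_; refl; cong; cong₂; trans; sym; subst; module ≡-Reasoning)
  open import Relation.Nullary using (contradiction)

  count-∧-false : ∀ m (V : List Step → Bool) → count (λ w → V w ∧ false) m ≡ 0
  count-∧-false m V = trans (count-cong m _ (λ _ → false) (λ w _ → Bool.∧-zeroʳ (V w))) (count-false m)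

  count-validAt-short : ∀ m h (Q : List Step → Bool) → m < h → count (λ w → validAt h w ∧ Q w) m ≡ 0
  count-validAt-short m h Q m<h = trans (count-cong m _ (λ _ → false) invalid) (count-false m)
    where invalid : ∀ w → length w ≡ m → (validAt h w ∧ Q w) ≡ false
          invalid w |w| with validAt h w in valid
          ... | true  = contradiction (subst (h ≤_) |w| (validAt⇒height≤length h w valid)) (ℕ.<⇒≱ m<h)
          ... | false = refl

  count-tie : ∀ m n k (V C : List Step → Bool) (t : List Step → ℕ) (b : Bool) (F : Ser) →
              (∀ k' → + count (λ w → V w ∧ (C w ∧ (t w ≡ᵇ k'))) m ≡ F n k') →
              + count (λ w → V w ∧ (C w ∧ (((if b then 1 else 0) + t w) ≡ᵇ k))) m ≡ tieIf b F n k
  count-tie m n k       V C t false F counts = counts k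
  count-tie m n zero    V C t true  F counts =
    trans (cong +_ (trans (count-cong m _ (λ w → V w ∧ false) (λ w _ → cong (V w ∧_) (Bool.∧-zeroʳ (C w))))
                          (count-∧-false m V)))
          (sym (sS⊗-zero F n))
  count-tie m n (suc k) V C t true  F counts = trans (counts k) (sym (sS⊗-suc F n k))

  module Automaton (a : ℕ) where

    open Ascending a

    -- w completes a path from height h whose previous peak had height p, in the given phase,
    -- with exactly k further ties
    accepts : Phase → ℕ → ℕ → ℕ → List Step → Bool
    accepts φ h p k w = validAt h w ∧ (admissible φ a p (peaksAt h w) ∧ (ties p (peaksAt h w) ≡ᵇ k))

    count-descPeak : ∀ m n h p k →
      (∀ k' → + count (accepts descending h (suc h) k') m ≡ desc h (suc h) n k') →
      + count (λ w → accepts descending h p k (u ∷ d ∷ w)) m ≡ descPeak h p n k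
    count-descPeak m n h p k counts with suc h ≤ᵇ p
    ... | false = cong +_ (count-∧-false m (validAt h))
    ... | true  = count-tie m n k (validAt h) (λ w → nonincr (suc h ∷ peaksAt h w)) (λ w → ties (suc h) (peaksAt h w))
                            (p ≡ᵇ suc h) (desc h (suc h)) counts

    count-ascPeak : ∀ m n h p k →
      (∀ k' → + count (accepts ascending h (suc h) k') m ≡ asc h (suc h) n k') →
      (∀ k' → + count (accepts descending h (suc h) k') m ≡ desc h (suc h) n k') →
      + count (λ w → accepts ascending h p k (u ∷ d ∷ w)) m ≡ ascPeak h p n k
    count-ascPeak m n h p k ascCounts descCounts with suc h <ᵇ a
    ... | true with p ≤ᵇ suc h
    ...   | false = cong +_ (count-∧-false m (validAt h))
    ...   | true  = count-tie m n k (validAt h) (λ w → admissible ascending a (suc h) (peaksAt h w))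
                              (λ w → ties (suc h) (peaksAt h w)) (p ≡ᵇ suc h) (asc h (suc h)) ascCounts
    count-ascPeak m n h p k ascCounts descCounts | false with suc h ≡ᵇ a
    ...   | false = cong +_ (count-∧-false m (validAt h))
    ...   | true  = count-tie m n k (validAt h) (λ w → nonincr (suc h ∷ peaksAt h w))
                              (λ w → ties (suc h) (peaksAt h w)) (p ≡ᵇ suc h) (desc h (suc h)) descCounts

    series : Phase → ℕ → ℕ → Ser
    series ascending  = asc
    series descending = desc

    upSeries : Phase → ℕ → ℕ → Ser
    upSeries ascending  = ascUp
    upSeries descending = descUp

    downSeries : Phase → ℕ → ℕ → Ser
    downSeries φ          (suc h) p = series φ h p
    downSeries ascending  zero    p = base
    downSeries descending zero    p = 𝟙

    series-split : ∀ φ h p → series φ h p ≡ downSeries φ h p ⊕ zS ⊗ upSeries φ h p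
    series-split ascending  zero    p = refl
    series-split descending zero    p = refl
    series-split ascending  (suc h) p = refl
    series-split descending (suc h) p = refl

    downSeries-suc : ∀ φ p n k → downSeries φ 0 p (suc n) k ≡ + 0
    downSeries-suc descending p n k = refl
    downSeries-suc ascending  p n k with a ≡ᵇ 0
    ... | true  = refl
    ... | false = refl

    count-empty : ∀ φ p k → + count (accepts φ 0 p k) 0 ≡ series φ 0 p 0 k
    count-empty φ p k = begin
        + count (accepts φ 0 p k) 0                    ≡⟨ cong +_ (count-zero (accepts φ 0 p k)) ⟩
        + toℕ (accepts φ 0 p k [])                     ≡⟨ empty φ k ⟩
        downSeries φ 0 p 0 k ℤ.+ + 0                   ≡⟨ cong (λ c → downSeries φ 0 p 0 k ℤ.+ c) (sym (zS⊗-zero (upSeries φ 0 p) k)) ⟩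
        downSeries φ 0 p 0 k ℤ.+ (zS ⊗ upSeries φ 0 p) 0 k   ≡⟨ cong (λ F → F 0 k) (sym (series-split φ 0 p)) ⟩
        series φ 0 p 0 k                               ∎
      where
      open ≡-Reasoning
      empty : ∀ φ k → + toℕ (accepts φ 0 p k []) ≡ downSeries φ 0 p 0 k ℤ.+ + 0
      empty descending zero    = refl
      empty descending (suc k) = refl
      empty ascending  k with a ≡ᵇ 0
      empty ascending  zero    | true = refl
      empty ascending  (suc k) | true = refl
      empty ascending  k       | false = refl

    -- Induction on the length m = 2n + h: a completion starts with d (down to height h - 1),
    -- with u u (the state moves up), or with the peak u d.
    mutual
      count-series : ∀ m φ h p k n → m ≡ n + n + h → + count (accepts φ h p k) m ≡ series φ h p n k
      count-series zero φ zero p k zero refl = count-empty φ p k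
      count-series (suc m) φ h p k n m+1≡2n+h = begin
          + count (accepts φ h p k) (suc m)
        ≡⟨ count-suc (accepts φ h p k) m ⟩
          + count (λ w → accepts φ h p k (u ∷ w)) m ℤ.+ + count (λ w → accepts φ h p k (d ∷ w)) m
        ≡⟨ ℤ.+-comm (+ count (λ w → accepts φ h p k (u ∷ w)) m) (+ count (λ w → accepts φ h p k (d ∷ w)) m) ⟩
          + count (λ w → accepts φ h p k (d ∷ w)) m ℤ.+ + count (λ w → accepts φ h p k (u ∷ w)) m
        ≡⟨ cong₂ ℤ._+_ (count-down n h m+1≡2n+h) (count-up m φ h p k n m+1≡2n+h) ⟩
          downSeries φ h p n k ℤ.+ (zS ⊗ upSeries φ h p) n k
        ≡⟨ cong (λ F → F n k) (sym (series-split φ h p)) ⟩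
          series φ h p n k
        ∎
        where
        open ≡-Reasoning
        count-down : ∀ n h → suc m ≡ n + n + h → + count (λ w → accepts φ h p k (d ∷ w)) m ≡ downSeries φ h p n k
        count-down (suc n) zero    _           = trans (cong +_ (count-false m)) (sym (downSeries-suc φ p n k))
        count-down n       (suc h) m+1≡2n+h+1 = count-series m φ h p k n (ℕ.suc-injective (trans m+1≡2n+h+1 (ℕ.+-suc (n + n) h)))

      count-up : ∀ m φ h p k n → suc m ≡ n + n + h →
                 + count (λ w → accepts φ h p k (u ∷ w)) m ≡ (zS ⊗ upSeries φ h p) n k
      count-up m φ h p k zero m+1≡h =
        trans (cong +_ (count-validAt-short m (suc h) _ (subst (λ x → m < suc x) m+1≡h (ℕ.m<n⇒m<1+n (ℕ.n<1+n m)))))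
              (sym (zS⊗-zero (upSeries φ h p) k))
      count-up m φ h p k (suc n) m+1≡2n+2+h =
        trans (count-upSeries m φ h p k n m≡2n+h+1) (sym (zS⊗-suc (upSeries φ h p) n k))
        where m≡2n+h+1 : m ≡ n + n + suc h
              m≡2n+h+1 = trans (ℕ.suc-injective m+1≡2n+2+h)
                               (trans (cong (_+ h) (ℕ.+-suc n n)) (sym (ℕ.+-suc (n + n) h)))

      count-upSeries : ∀ m φ h p k n → m ≡ n + n + suc h →
                       + count (λ w → accepts φ h p k (u ∷ w)) m ≡ upSeries φ h p n k
      count-upSeries zero    φ h p k zero    ()
      count-upSeries zero    φ h p k (suc n) ()
      count-upSeries (suc m) φ h p k n m+1≡2n+h+1 = begin
          + count (λ w → accepts φ h p k (u ∷ w)) (suc m)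
        ≡⟨ count-suc (λ w → accepts φ h p k (u ∷ w)) m ⟩
          + count (λ w → accepts φ (suc h) p k (u ∷ w)) m ℤ.+ + count (λ w → accepts φ h p k (u ∷ d ∷ w)) m
        ≡⟨ cong₂ ℤ._+_ (count-up m φ (suc h) p k n m+1≡2n+h+1) (count-peak φ) ⟩
          (zS ⊗ upSeries φ (suc h) p) n k ℤ.+ peakSeries φ h p n k
        ≡⟨ sym (coeff (upSeries-recurrence φ h p) n k) ⟩
          upSeries φ h p n k
        ∎
        where
        open ≡-Reasoning
        m≡2n+h : m ≡ n + n + h
        m≡2n+h = ℕ.suc-injective (trans m+1≡2n+h+1 (ℕ.+-suc (n + n) h))
        peakSeries : Phase → ℕ → ℕ → Ser
        peakSeries ascending  = ascPeak
        peakSeries descending = descPeak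
        upSeries-recurrence : ∀ φ h p → upSeries φ h p ≈ zS ⊗ upSeries φ (suc h) p ⊕ peakSeries φ h p
        upSeries-recurrence ascending  = ascUp-recurrence
        upSeries-recurrence descending = descUp-recurrence
        count-peak : ∀ φ → + count (λ w → accepts φ h p k (u ∷ d ∷ w)) m ≡ peakSeries φ h p n k
        count-peak ascending  = count-ascPeak m n h p k (λ k' → count-series m ascending h (suc h) k' n m≡2n+h)
                                                        (λ k' → count-series m descending h (suc h) k' n m≡2n+h)
        count-peak descending = count-descPeak m n h p k (λ k' → count-series m descending h (suc h) k' n m≡2n+h)

open FiniteSums using (sumTo-cong; sumTo-if-0; sumTo-truncate)
open WordCounting using (toℕ; count; count-split; sumTo-toℕ-∧)
open PeakSequences
open StateSeries using (asc-start)
open RightHandSide using (term-vanishesBelow)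
open Transfer using (module Automaton)
open import Data.Bool using (if_then_else_; _∧_)
open import Data.Nat using (ℕ; suc; _+_; _≤_; _≡ᵇ_)
import Data.Nat.Properties as ℕ
open import Data.Integer as ℤ using (+_)
open import Data.List using (length)
open import Relation.Binary.PropositionalEquality using (_≡_; trans; sym; cong; subst; module ≡-Reasoning)

lhsCoeff≡Σ-accepts : ∀ n k → + lhsCoeff n k ≡ sumTo (n + n) (λ a → + count (Automaton.accepts a ascending 0 0 k) (n + n))
lhsCoeff≡Σ-accepts n k = count-split (n + n) (n + n) _ (λ a → Automaton.accepts a ascending 0 0 k) pointwise
  where
  pointwise : ∀ w → length w ≡ n + n →
              + toℕ (isDyck w ∧ (weaklyUnimodal (peaks w) ∧ (sval w ≡ᵇ k)))
              ≡ sumTo (n + n) (λ a → + toℕ (Automaton.accepts a ascending 0 0 k w))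
  pointwise w |w| rewrite ties-peaksAt 0 w | weaklyUnimodal≡unimodalFrom0 (peaks w) =
    sym (sumTo-toℕ-∧ (n + n) (validAt 0 w) (sval w ≡ᵇ k) (λ a → admissible ascending a 0 (peaks w)) (unimodalFrom 0 (peaks w))
                     (sumTo-admissible (n + n) (peaks w) (subst (maximum (peaks w) ≤_) |w| (maximum-peaksAt 0 w))))

mainTheorem18 : (n k : ℕ) → + (lhsCoeff n k) ≡ rhs n k
mainTheorem18 n k = begin
    + lhsCoeff n k
  ≡⟨ lhsCoeff≡Σ-accepts n k ⟩
    sumTo (n + n) (λ a → + count (Automaton.accepts a ascending 0 0 k) (n + n))
  ≡⟨ sumTo-cong (n + n) (λ a _ → trans (Automaton.count-series a (n + n) ascending 0 0 k n (sym (ℕ.+-identityʳ (n + n))))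
                                        (asc-start n k a)) ⟩
    sumTo (n + n) (λ a → if a ≡ᵇ 0 then 𝟙 n k else term a n k)
  ≡⟨ sumTo-if-0 (n + n) (𝟙 n k) (λ a → term a n k) ⟩
    𝟙 n k ℤ.+ sumTo (n + n) (λ a → if a ≡ᵇ 0 then + 0 else term a n k)
  ≡⟨ cong (λ s → 𝟙 n k ℤ.+ s)
          (sumTo-truncate (n + n) n _ (ℕ.m≤m+n n n) (λ { (suc a) n<a _ → term-vanishesBelow (suc a) n k n<a })) ⟩
    rhs n k
  ∎
  where open ≡-Reasoning
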